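{- Let $w_n=\sum_{\pi\in\mathcal{D}_{12\text{ - }3}(n)}y^{\mu(\pi)}$ for $n\ge2$, and for $n\ge3$ and $2\le i\le n-1$ let $w_{n,i}$ be the same sum restricted to those $\pi$ whose flattened form starts with the letters $1,n,i$. Then for $n\ge5$, $$w_{n,i}=w_{n-2}+\sum_{j=2}^{i-1}w_{n-1,j},\qquad 3\le i\le n-2,$$ and moreover $w_{n,2}=(1+y)w_{n-2}$ and $w_{n,n-1}=w_{n-1}$ (for $n\ge5$), with initial conditions $w_{3,2}=w_{4,3}=y$ and $w_{4,2}=y^2+y$.
   Context: Every permutation $\pi$ of $[n]=\{1,\dots,n\}$ is written in standard cycle form: each cycle is written starting with its smallest element, and the cycles are ordered from left to right by increasing first elements. The flattened form $\mathrm{flat}(\pi)$ is the word (in one-line notation) obtained by erasing the parentheses of the standard cycle form. A derangement is a permutation with no fixed points; $\mathcal{D}(n)$ is the set of derangements of $[n]$, and $\mu(\pi)$ denotes the number of cycles of $\pi$. A word $w=w_1\cdots w_n$ of distinct integers contains the vincular pattern $12\text{ - }3$ if there are indices $i$ and $k>i+1$ with $w_i<w_{i+1}<w_k$, and avoids it otherwise. $\mathcal{D}_{12\text{ - }3}(n)$ is the set of $\pi\in\mathcal{D}(n)$ such that $\mathrm{flat}(\pi)$ avoids $12\text{ - }3$. -}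

module Defs where

open import Data.Nat using (ℕ; zero; suc; _+_; _∸_; _<ᵇ_; _≡ᵇ_)
open import Data.Bool using (Bool; true; false; not; _∧_; if_then_else_)
open import Data.List using (List; []; _∷_; map; concatMap; concat; length; upTo; filterᵇ; _++_)
open import Data.Bool.ListAction using (and; any)
open import Data.Nat.ListAction using (sum)

oneTo : ℕ → List ℕ
oneTo n = map suc (upTo n)

insertions : ℕ → List ℕ → List (List ℕ)
insertions x []       = (x ∷ []) ∷ []
insertions x (y ∷ ys) = (x ∷ y ∷ ys) ∷ map (y ∷_) (insertions x ys)

arrangements : List ℕ → List (List ℕ)
arrangements []       = [] ∷ []
arrangements (x ∷ xs) = concatMap (insertions x) (arrangements xs)

-- S n : all permutations of [n], one-line notation π(1) π(2) … π(n)
S : ℕ → List (List ℕ)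
S n = arrangements (oneTo n)

-- π(x), i.e. the x-th entry (1-indexed) of the one-line notation
app : List ℕ → ℕ → ℕ
app []       _             = 0
app (y ∷ ys) zero          = 0
app (y ∷ ys) (suc zero)    = y
app (y ∷ ys) (suc (suc m)) = app ys (suc m)

-- the cycle of π containing a, written starting at a: (a π(a) π²(a) …)
-- (fuel = length π suffices since cycles have length ≤ n)
cycleFrom : List ℕ → ℕ → List ℕ
cycleFrom π a = a ∷ go (length π) (app π a)
  where
  go : ℕ → ℕ → List ℕ
  go zero    x = []
  go (suc f) x = if x ≡ᵇ a then [] else x ∷ go f (app π x)

_∈ᵇ_ : ℕ → List ℕ → Bool
x ∈ᵇ xs = any (x ≡ᵇ_) xs

-- Standard cycle form: scan a = 1,2,…,n; the first time an element a not
-- yet lying in an already written cycle is met, it is the smallest element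
-- of its cycle, and its cycle is written starting with a.  Hence each cycle
-- starts with its smallest element and cycles appear by increasing first
-- elements.
cycleForm : List ℕ → List (List ℕ)
cycleForm π = loop (oneTo (length π)) []
  where
  loop : List ℕ → List ℕ → List (List ℕ)
  loop []       seen = []
  loop (a ∷ as) seen =
    if a ∈ᵇ seen then loop as seen
    else cycleFrom π a ∷ loop as (cycleFrom π a ++ seen)

flat : List ℕ → List ℕ
flat π = concat (cycleForm π)

μ : List ℕ → ℕ
μ π = length (cycleForm π)

isDerangement : List ℕ → Bool
isDerangement π = and (map (λ x → not (app π x ≡ᵇ x)) (oneTo (length π)))

-- w contains 12-3 iff there are i and k > i+1 with w_i < w_{i+1} < w_k
contains12-3 : List ℕ → Bool
contains12-3 []                = false
contains12-3 (a ∷ [])          = false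
contains12-3 (a ∷ b ∷ rest)    =
  ((a <ᵇ b) ∧ any (b <ᵇ_) rest) Data.Bool.∨ contains12-3 (b ∷ rest)

D12-3 : ℕ → List (List ℕ)
D12-3 n = filterᵇ (λ π → isDerangement π ∧ not (contains12-3 (flat π))) (S n)

-- Polynomials in y with natural-number coefficients, represented by their
-- coefficient sequence: p k = coefficient of y^k.

Poly : Set
Poly = ℕ → ℕ

_≈ₚ_ : Poly → Poly → Set
p ≈ₚ q = ∀ k → p k Relation.Binary.PropositionalEquality.≡ q k
  where import Relation.Binary.PropositionalEquality

infix 4 _≈ₚ_

_⊕_ : Poly → Poly → Poly
(p ⊕ q) k = p k + q k

infixl 6 _⊕_

y·_ : Poly → Poly
(y· p) zero    = 0
(y· p) (suc k) = p k

[1+y]·_ : Poly → Poly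
[1+y]· p = p ⊕ y· p

yˆ : ℕ → Poly
yˆ m k = if k ≡ᵇ m then 1 else 0

-- Σ_{j=a}^{b} f j   (empty if b < a)
ΣP : ℕ → ℕ → (ℕ → Poly) → Poly
ΣP a b f k = sum (map (λ j → f (a + j) k) (upTo (suc b ∸ a)))

countμ : List (List ℕ) → Poly
countμ πs k = length (filterᵇ (λ π → μ π ≡ᵇ k) πs)

w : ℕ → Poly
w n = countμ (D12-3 n)

startsWith1ni : ℕ → ℕ → List ℕ → Bool
startsWith1ni n i (a ∷ b ∷ c ∷ _) = (a ≡ᵇ 1) ∧ (b ≡ᵇ n) ∧ (c ≡ᵇ i)
startsWith1ni n i _               = false

wi : ℕ → ℕ → Poly
wi n i = countμ (filterᵇ (λ π → startsWith1ni n i (flat π)) (D12-3 n))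

{-# OPTIONS --safe #-}
module Submission where

-- A permutation of [1, n] is the same thing as its standard cycle form: a list of cycles, each
-- written from its least letter, ordered by first letters.  Derangements are the forms whose
-- cycles all have at least two letters, and μ counts the cycles.  If flat(π) avoids 12-3, nothing
-- after the ascent 1 < π(1) exceeds π(1), so every form starts (1 n …).  Now fix the third letter i.
-- If the fourth letter y exceeds i, every later letter is below y, and deleting n and i and closing
-- the gaps is a cycle-preserving bijection onto the forms counted by w_{n-2}.  Otherwise, for i ≥ 3,
-- the letter after i is smaller than i, and deleting i is a bijection onto the forms of [1, n-1]
-- whose third letter is below i, counted by Σ_{j<i} w_{n-1,j}; for i = n-1 these are all forms.
-- For i = 2 the remaining forms are (1 n)(2 …)…, and deleting the cycle (1 n) gives the forms
-- counted by w_{n-2} with one cycle less, hence the factor y.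

open import Defs
open import Data.Nat using (ℕ; _≤_; _∸_; zero; suc; _+_; _<_; z≤n; s≤s; _≡ᵇ_; _<ᵇ_; _≟_; _<?_)
open import Data.Product using (_×_; Σ; _,_; proj₁; proj₂; ∃)

open import Data.Bool using (Bool; true; false; not; _∧_; _∨_; if_then_else_; T)
open import Data.Bool.Properties using (T-∧; T-not-≡; ∨-conicalˡ; ∨-conicalʳ; ∧-zeroʳ)
open import Data.Bool.ListAction using (any; all)
open import Data.Empty using (⊥; ⊥-elim)
open import Data.List using (List; []; _∷_; map; drop; concatMap; concat; length; upTo; applyUpTo; filterᵇ; _++_; [_]; _∷ʳ_)
open import Data.List.Properties
  using (length-map; map-++; map-∘; ++-assoc; map-applyUpTo; length-applyUpTo; ∷-injectiveˡ; ∷-injectiveʳ;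
         filter-none; upTo-∷ʳ)
open import Data.List.Membership.Propositional using (_∈_; _∉_; find; lose)
open import Data.List.Membership.Propositional.Properties
  using (∈-map⁺; ∈-map⁻; ∈-++⁺ˡ; ∈-++⁺ʳ; ∈-++⁻; ∈-∃++; ∈-concat⁻′; ∈-filter⁺; ∈-filter⁻;
         ∈-applyUpTo⁺; ∈-applyUpTo⁻; ∈-concatMap⁺; ∈-concatMap⁻)
open import Data.List.Membership.Propositional.Properties.WithK using (unique∧set⇒bag)
open import Data.List.Membership.DecPropositional _≟_ using (_∈?_)
open import Data.List.Relation.Binary.BagAndSetEquality using (∼bag⇒↭)
open import Data.List.Relation.Binary.Permutation.Propositional using (_↭_; prep; swap; ↭-sym; ↭-trans; ↭-refl; ↭⇒↭ₛ)
open import Data.List.Relation.Binary.Permutation.Propositional.Properties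
  using (↭-length; drop-mid; ∈-resp-↭; shift; shifts; ++⁺; ++⁺ʳ; ∷↭∷ʳ)
import Data.List.Relation.Binary.Permutation.Setoid.Properties as ↭ₛ
open import Data.List.Relation.Unary.All as All using (All; []; _∷_)
open import Data.List.Relation.Unary.All.Properties using (all⁺; all⁻; map⁺) renaming (++⁺ to All-++⁺)
open import Data.List.Relation.Unary.Any as Any using (here; there)
open import Data.List.Relation.Unary.Any.Properties using (any⁺; any⁻)
open import Data.List.Relation.Unary.Unique.Propositional using (Unique; []; _∷_)
open import Data.List.Relation.Unary.Unique.Propositional.Properties as Unique using (filter⁺; upTo⁺; Unique[x∷xs]⇒x∉xs)
open import Data.Nat.Properties
open import Data.Nat.GeneralisedArithmetic using (iterate)
open import Data.Nat.ListAction using (sum)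
open import Data.Nat.ListAction.Properties using (sum-++)
open import Data.Sum as Sum using (_⊎_; inj₁; inj₂; [_,_]′)
open import Data.Unit using (⊤; tt)
open import Function.Base using (_∘_; id; _∋_; case_of_; flip)
open import Function.Bundles using (mk⇔; Equivalence)
open import Relation.Binary.Definitions using (tri<; tri≈; tri>)
open import Relation.Binary.PropositionalEquality
  using (_≡_; _≢_; refl; sym; trans; cong; cong₂; subst; subst₂; setoid; module ≡-Reasoning)
open import Relation.Nullary using (¬_; yes; no; contradiction)
open import Relation.Nullary.Decidable using (T?)

private variable
  A B : Set

open Equivalence using (to; from)

≡ᵇ-refl : ∀ n → T (n ≡ᵇ n)
≡ᵇ-refl n = ≡⇒≡ᵇ n n refl

≢⇒≡ᵇ-false : ∀ {m n} → m ≢ n → (m ≡ᵇ n) ≡ false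
≢⇒≡ᵇ-false {m} {n} m≢n with m ≡ᵇ n in eq
... | true  = contradiction (≡ᵇ⇒≡ m n (subst T (sym eq) tt)) m≢n
... | false = refl

if-T : ∀ {b} {x y : A} → T b → (if b then x else y) ≡ x
if-T {b = true} _ = refl

T-⇔⇒≡ : ∀ {a b} → (T a → T b) → (T b → T a) → a ≡ b
T-⇔⇒≡ {false} {false} _ _ = refl
T-⇔⇒≡ {false} {true}  _ b⇒a = ⊥-elim (b⇒a tt)
T-⇔⇒≡ {true}  {false} a⇒b _ = ⊥-elim (a⇒b tt)
T-⇔⇒≡ {true}  {true}  _ _ = refl

≥⇒<ᵇ-false : ∀ {x y} → y ≤ x → (x <ᵇ y) ≡ false
≥⇒<ᵇ-false {x} {y} y≤x with x <ᵇ y in x<ᵇy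
... | true  = ⊥-elim (<⇒≱ (<ᵇ⇒< x y (subst T (sym x<ᵇy) tt)) y≤x)
... | false = refl

∈-tail² : ∀ {x a b : ℕ} {r} → x ∈ a ∷ b ∷ r → x ≢ a → x ≢ b → x ∈ r
∈-tail² (here x≡a)         x≢a _   = contradiction x≡a x≢a
∈-tail² (there (here x≡b)) _   x≢b = contradiction x≡b x≢b
∈-tail² (there (there x∈)) _   _   = x∈

Unique-resp-↭ : {xs ys : List ℕ} → xs ↭ ys → Unique xs → Unique ys
Unique-resp-↭ p = ↭ₛ.Unique-resp-↭ (setoid ℕ) (↭⇒↭ₛ p)

Unique-map⁺ : (f : A → B) {xs : List A} → Unique xs →
  (∀ {x y} → x ∈ xs → y ∈ xs → f x ≡ f y → x ≡ y) → Unique (map f xs)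
Unique-map⁺ f [] inj = []
Unique-map⁺ f {x ∷ xs} (x∉xs ∷ u) inj =
  All.tabulate (λ z∈ fx≡z → let (y , y∈xs , z≡fy) = ∈-map⁻ f z∈ in
                 All.lookup x∉xs y∈xs (inj (here refl) (there y∈xs) (trans fx≡z z≡fy)))
  ∷ Unique-map⁺ f u (λ p q → inj (there p) (there q))

module _ {As : List A} {Bs : List B} (p : A → Bool) (q : B → Bool) (Φ : A → B) (Ψ : B → A) where

  length-filterᵇ-bij : Unique As → Unique Bs →
    (∀ {a} → a ∈ As → T (p a) → Φ a ∈ Bs × T (q (Φ a)) × Ψ (Φ a) ≡ a) →
    (∀ {b} → b ∈ Bs → T (q b) → Ψ b ∈ As × T (p (Ψ b)) × Φ (Ψ b) ≡ b) →
    length (filterᵇ p As) ≡ length (filterᵇ q Bs)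
  length-filterᵇ-bij uA uB forth back = begin
    length (filterᵇ p As)         ≡⟨ length-map Φ (filterᵇ p As) ⟨
    length (map Φ (filterᵇ p As)) ≡⟨ ↭-length (∼bag⇒↭ (unique∧set⇒bag uΦ (filter⁺ (T? ∘ q) uB) (mk⇔ ⊆ ⊇))) ⟩
    length (filterᵇ q Bs)         ∎
    where
    open ≡-Reasoning
    uΦ : Unique (map Φ (filterᵇ p As))
    uΦ = Unique-map⁺ Φ (filter⁺ (T? ∘ p) uA) λ x∈ y∈ Φx≡Φy →
      let (x∈As , px) = ∈-filter⁻ (T? ∘ p) x∈
          (y∈As , py) = ∈-filter⁻ (T? ∘ p) y∈
      in trans (sym (proj₂ (proj₂ (forth x∈As px))))
               (trans (cong Ψ Φx≡Φy) (proj₂ (proj₂ (forth y∈As py))))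
    ⊆ : ∀ {b} → b ∈ map Φ (filterᵇ p As) → b ∈ filterᵇ q Bs
    ⊆ b∈ with a , a∈ , refl ← ∈-map⁻ Φ b∈ =
      let (a∈As , pa) = ∈-filter⁻ (T? ∘ p) a∈
          (Φa∈Bs , qΦa , _) = forth a∈As pa
      in ∈-filter⁺ (T? ∘ q) Φa∈Bs qΦa
    ⊇ : ∀ {b} → b ∈ filterᵇ q Bs → b ∈ map Φ (filterᵇ p As)
    ⊇ b∈ =
      let (b∈Bs , qb) = ∈-filter⁻ (T? ∘ q) b∈
          (Ψb∈As , pΨb , ΦΨb≡b) = back b∈Bs qb
      in subst (_∈ map Φ (filterᵇ p As)) ΦΨb≡b (∈-map⁺ Φ (∈-filter⁺ (T? ∘ p) Ψb∈As pΨb))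

filterᵇ-filterᵇ : (p q : A → Bool) (xs : List A) → filterᵇ q (filterᵇ p xs) ≡ filterᵇ (λ x → p x ∧ q x) xs
filterᵇ-filterᵇ p q [] = refl
filterᵇ-filterᵇ p q (x ∷ xs) with p x
... | false = filterᵇ-filterᵇ p q xs
... | true with q x
...   | true  = cong (x ∷_) (filterᵇ-filterᵇ p q xs)
...   | false = filterᵇ-filterᵇ p q xs

filterᵇ-cong : (p q : A → Bool) (xs : List A) → (∀ {x} → x ∈ xs → p x ≡ q x) → filterᵇ p xs ≡ filterᵇ q xs
filterᵇ-cong p q [] _ = refl
filterᵇ-cong p q (x ∷ xs) p≗q with p x | q x | p≗q (here refl)
... | true  | true  | _ = cong (x ∷_) (filterᵇ-cong p q xs (p≗q ∘ there))
... | false | false | _ = filterᵇ-cong p q xs (p≗q ∘ there)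

length-filterᵇ-split : (p q : A → Bool) (xs : List A) →
  length (filterᵇ p xs) ≡ length (filterᵇ (λ x → p x ∧ q x) xs) + length (filterᵇ (λ x → p x ∧ not (q x)) xs)
length-filterᵇ-split p q [] = refl
length-filterᵇ-split p q (x ∷ xs) with p x
... | false = length-filterᵇ-split p q xs
... | true with q x
...   | true  = cong suc (length-filterᵇ-split p q xs)
...   | false = trans (cong suc (length-filterᵇ-split p q xs)) (sym (+-suc _ _))

length-filterᵇ-none : (p : A → Bool) (xs : List A) → (∀ {x} → x ∈ xs → ¬ T (p x)) → length (filterᵇ p xs) ≡ 0
length-filterᵇ-none p xs none = cong length (filter-none (T? ∘ p) (All.tabulate none))

Unique-++⁻ : (xs : List A) {ys : List A} → Unique (xs ++ ys) → Unique xs × Unique ys × (∀ {x} → x ∈ xs → x ∉ ys)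
Unique-++⁻ [] u = [] , u , λ ()
Unique-++⁻ (x ∷ xs) (x∉ ∷ u) =
  let (uxs , uys , disjoint) = Unique-++⁻ xs u in
  All.tabulate (All.lookup x∉ ∘ ∈-++⁺ˡ) ∷ uxs , uys ,
  λ { (here refl) y∈ → All.lookup x∉ (∈-++⁺ʳ xs y∈) refl ; (there x∈) y∈ → disjoint x∈ y∈ }

Unique⇒length≤ : {xs ys : List A} → Unique xs → (∀ {x} → x ∈ xs → x ∈ ys) → length xs ≤ length ys
Unique⇒length≤ {xs = []} _ _ = z≤n
Unique⇒length≤ {xs = x ∷ xs} (x∉xs ∷ u) xs⊆ys with as , bs , refl ← ∈-∃++ (xs⊆ys (here refl)) =
  subst (suc (length xs) ≤_) (sym (length-middle as))
    (s≤s (Unique⇒length≤ u (λ y∈ → delete-middle as (xs⊆ys (there y∈)) (All.lookup x∉xs y∈ ∘ sym))))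
  where
  length-middle : ∀ as {x bs} → length (as ++ x ∷ bs) ≡ suc (length (as ++ bs))
  length-middle []       = refl
  length-middle (a ∷ as) = cong suc (length-middle as)
  delete-middle : ∀ {z x} as {bs} → z ∈ as ++ x ∷ bs → z ≢ x → z ∈ as ++ bs
  delete-middle []       (here z≡x) z≢x = contradiction z≡x z≢x
  delete-middle []       (there z∈) _   = z∈
  delete-middle (a ∷ as) (here z≡a) _   = here z≡a
  delete-middle (a ∷ as) (there z∈) z≢x = there (delete-middle as z∈ z≢x)

Unique-concatMap⁺ : (g : A → List B) {xs : List A} → Unique xs → (∀ {x} → x ∈ xs → Unique (g x)) →
  (∀ {x x′ z} → x ∈ xs → x′ ∈ xs → z ∈ g x → z ∈ g x′ → x ≡ x′) → Unique (concatMap g xs)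
Unique-concatMap⁺ g [] _ _ = []
Unique-concatMap⁺ g {x ∷ xs} (x∉xs ∷ u) ug disjoint =
  Unique.++⁺ (ug (here refl)) (Unique-concatMap⁺ g u (ug ∘ there) (λ p q → disjoint (there p) (there q)))
    λ (z∈gx , z∈rest) →
      let (x′ , x′∈xs , z∈gx′) = find (∈-concatMap⁻ g z∈rest) in
      All.lookup x∉xs x′∈xs (disjoint (here refl) (there x′∈xs) z∈gx z∈gx′)

-- S m enumerates the permutations of [1, m]

∈-insertions⁻ : ∀ (x : ℕ) ys {zs} → zs ∈ insertions x ys → zs ↭ x ∷ ys
∈-insertions⁻ x []       (here refl) = ↭-refl
∈-insertions⁻ x (y ∷ ys) (here refl) = ↭-refl
∈-insertions⁻ x (y ∷ ys) (there zs∈) with zs′ , zs′∈ , refl ← ∈-map⁻ (y ∷_) zs∈ =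
  ↭-trans (prep y (∈-insertions⁻ x ys zs′∈)) (swap y x ↭-refl)

∈-insertions⁺ : ∀ (x : ℕ) as bs → as ++ x ∷ bs ∈ insertions x (as ++ bs)
∈-insertions⁺ x []       []       = here refl
∈-insertions⁺ x []       (b ∷ bs) = here refl
∈-insertions⁺ x (a ∷ as) bs       = there (∈-map⁺ (a ∷_) (∈-insertions⁺ x as bs))

∈-arrangements⁻ : ∀ xs {ys} → ys ∈ arrangements xs → ys ↭ xs
∈-arrangements⁻ []       (here refl) = ↭-refl
∈-arrangements⁻ (x ∷ xs) ys∈ with zs , zs∈ , ys∈′ ← find (∈-concatMap⁻ (insertions x) ys∈) =
  ↭-trans (∈-insertions⁻ x zs ys∈′) (prep x (∈-arrangements⁻ xs zs∈))

∈-arrangements⁺ : ∀ xs {ys} → ys ↭ xs → ys ∈ arrangements xs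
∈-arrangements⁺ []       {[]}    _ = here refl
∈-arrangements⁺ []       {_ ∷ _} p with () ← ↭-length p
∈-arrangements⁺ (x ∷ xs) p with as , bs , refl ← ∈-∃++ (∈-resp-↭ (↭-sym p) (here refl)) =
  ∈-concatMap⁺ (insertions x) (lose (∈-arrangements⁺ xs (drop-mid as [] p)) (∈-insertions⁺ x as bs))

remove : ℕ → List ℕ → List ℕ
remove x []       = []
remove x (y ∷ ys) = if y ≡ᵇ x then ys else y ∷ remove x ys

remove-insertion : ∀ x ys {zs} → x ∉ ys → zs ∈ insertions x ys → remove x zs ≡ ys
remove-insertion x []       _    (here refl) = if-T (≡ᵇ-refl x)
remove-insertion x (y ∷ ys) _    (here refl) = if-T (≡ᵇ-refl x)
remove-insertion x (y ∷ ys) x∉ys (there zs∈) with zs′ , zs′∈ , refl ← ∈-map⁻ (y ∷_) zs∈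
  rewrite ≢⇒≡ᵇ-false {y} {x} (x∉ys ∘ here ∘ sym) = cong (y ∷_) (remove-insertion x ys (x∉ys ∘ there) zs′∈)

insertions-unique : ∀ x ys → x ∉ ys → Unique (insertions x ys)
insertions-unique x []       _    = [] ∷ []
insertions-unique x (y ∷ ys) x∉ys =
  All.tabulate (λ zs∈ x∷y∷ys≡ → let (_ , _ , ≡y∷) = ∈-map⁻ (y ∷_) zs∈ in
                 x∉ys (here (∷-injectiveˡ (trans x∷y∷ys≡ ≡y∷))))
  ∷ Unique-map⁺ (y ∷_) (insertions-unique x ys (x∉ys ∘ there)) (λ _ _ → ∷-injectiveʳ)

arrangements-unique : ∀ xs → Unique xs → Unique (arrangements xs)
arrangements-unique []       _           = [] ∷ []
arrangements-unique (x ∷ xs) (x∉xs ∷ u) =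
  Unique-concatMap⁺ (insertions x) (arrangements-unique xs u)
    (λ ys∈ → insertions-unique x _ (fresh ys∈))
    (λ ys∈ ys′∈ zs∈ zs∈′ → trans (sym (remove-insertion x _ (fresh ys∈) zs∈)) (remove-insertion x _ (fresh ys′∈) zs∈′))
  where
  fresh : ∀ {ys} → ys ∈ arrangements xs → x ∉ ys
  fresh ys∈ x∈ys = All.lookup x∉xs (∈-resp-↭ (∈-arrangements⁻ xs ys∈) x∈ys) refl

InRange : ℕ → ℕ → Set
InRange m x = 1 ≤ x × x ≤ m

oneTo≡applyUpTo : ∀ m → oneTo m ≡ applyUpTo suc m
oneTo≡applyUpTo = map-applyUpTo id suc

∈-oneTo⁻ : ∀ m {x} → x ∈ oneTo m → InRange m x
∈-oneTo⁻ m x∈ with i , i<m , refl ← ∈-applyUpTo⁻ suc (subst (_ ∈_) (oneTo≡applyUpTo m) x∈) = s≤s z≤n , i<m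

∈-oneTo⁺ : ∀ m {x} → InRange m x → x ∈ oneTo m
∈-oneTo⁺ m {suc x} (_ , x<m) = subst (_ ∈_) (sym (oneTo≡applyUpTo m)) (∈-applyUpTo⁺ suc x<m)

oneTo-unique : ∀ m → Unique (oneTo m)
oneTo-unique m = Unique.map⁺ suc-injective (upTo⁺ m)

length-oneTo : ∀ m → length (oneTo m) ≡ m
length-oneTo m = trans (length-map suc (upTo m)) (length-applyUpTo id m)

app-applyUpTo : ∀ (h : ℕ → ℕ) m x → x < m → app (applyUpTo h m) (suc x) ≡ h x
app-applyUpTo h (suc m) zero    _         = refl
app-applyUpTo h (suc m) (suc x) (s≤s x<m) = app-applyUpTo (h ∘ suc) m x x<m

app-map-oneTo : ∀ (g : ℕ → ℕ) m {x} → InRange m x → app (map g (oneTo m)) x ≡ g x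
app-map-oneTo g m {suc x} (_ , x<m) = begin
  app (map g (map suc (upTo m))) (suc x) ≡⟨ cong (λ l → app l (suc x)) (sym (map-∘ (upTo m))) ⟩
  app (map (g ∘ suc) (upTo m)) (suc x)   ≡⟨ cong (λ l → app l (suc x)) (map-applyUpTo id (g ∘ suc) m) ⟩
  app (applyUpTo (g ∘ suc) m) (suc x)    ≡⟨ app-applyUpTo (g ∘ suc) m x x<m ⟩
  g (suc x)                              ∎
  where open ≡-Reasoning

app-∈ : ∀ (l : List ℕ) {x} → InRange (length l) x → app l x ∈ l
app-∈ (y ∷ l) {suc zero}    _             = here refl
app-∈ (y ∷ l) {suc (suc x)} (_ , s≤s x<l) = there (app-∈ l (s≤s z≤n , x<l))

app-injective : ∀ (l : List ℕ) → Unique l → ∀ {x y} → InRange (length l) x → InRange (length l) y → app l x ≡ app l y → x ≡ y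
app-injective (z ∷ l) u        {suc zero}    {suc zero}    _              _              _  = refl
app-injective (z ∷ l) (z∉ ∷ u) {suc zero}    {suc (suc y)} _              (_ , s≤s y<l)  eq =
  contradiction eq (All.lookup z∉ (app-∈ l (s≤s z≤n , y<l)))
app-injective (z ∷ l) (z∉ ∷ u) {suc (suc x)} {suc zero}    (_ , s≤s x<l)  _              eq =
  contradiction (sym eq) (All.lookup z∉ (app-∈ l (s≤s z≤n , x<l)))
app-injective (z ∷ l) (z∉ ∷ u) {suc (suc x)} {suc (suc y)} (_ , s≤s x<l)  (_ , s≤s y<l)  eq =
  cong suc (app-injective l u (s≤s z≤n , x<l) (s≤s z≤n , y<l) eq)

app-ext : ∀ (l l′ : List ℕ) → length l ≡ length l′ → (∀ {x} → InRange (length l) x → app l x ≡ app l′ x) → l ≡ l′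
app-ext []      []       _   _    = refl
app-ext (y ∷ l) (y′ ∷ l′) len eqAt =
  cong₂ _∷_ (eqAt (s≤s z≤n , s≤s z≤n))
    (app-ext l l′ (suc-injective len) λ { {suc x} (_ , x≤) → eqAt (s≤s z≤n , s≤s x≤) })

module _ {m : ℕ} {π : List ℕ} (π∈S : π ∈ S m) where

  ∈S⇒↭ : π ↭ oneTo m
  ∈S⇒↭ = ∈-arrangements⁻ (oneTo m) π∈S

  ∈S⇒length : length π ≡ m
  ∈S⇒length = trans (↭-length ∈S⇒↭) (length-oneTo m)

  ∈S⇒Unique : Unique π
  ∈S⇒Unique = Unique-resp-↭ (↭-sym ∈S⇒↭) (oneTo-unique m)

  ∈S⇒inRange-length : ∀ {x} → InRange m x → InRange (length π) x
  ∈S⇒inRange-length = subst (λ k → InRange k _) (sym ∈S⇒length)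

  ∈S⇒app-inRange : ∀ {x} → InRange m x → InRange m (app π x)
  ∈S⇒app-inRange x∈ = ∈-oneTo⁻ m (∈-resp-↭ ∈S⇒↭ (app-∈ π (∈S⇒inRange-length x∈)))

  ∈S⇒app-injective : ∀ {x y} → InRange m x → InRange m y → app π x ≡ app π y → x ≡ y
  ∈S⇒app-injective x∈ y∈ = app-injective π ∈S⇒Unique (∈S⇒inRange-length x∈) (∈S⇒inRange-length y∈)

S-unique : ∀ m → Unique (S m)
S-unique m = arrangements-unique (oneTo m) (oneTo-unique m)

-- Orbits and the standard cycle form

Cycles : Set
Cycles = List (List ℕ)

Edge : (ℕ → ℕ) → ℕ × ℕ → Set
Edge f (x , y) = f x ≡ y

-- edgesFrom h x t: the steps x → t₁ → t₂ → … → h of a cycle that is closed at h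
edgesFrom : ℕ → ℕ → List ℕ → List (ℕ × ℕ)
edgesFrom h x []      = (x , h) ∷ []
edgesFrom h x (y ∷ t) = (x , y) ∷ edgesFrom h y t

IsCycleOf : (ℕ → ℕ) → List ℕ → Set
IsCycleOf f []      = ⊥
IsCycleOf f (h ∷ t) = All (Edge f) (edgesFrom h h t)

Ordered : Cycles → Set
Ordered []            = ⊤
Ordered ([] ∷ C)      = ⊥
Ordered ((h ∷ t) ∷ C) = All (h <_) t × All (h <_) (concat C) × Ordered C

record Standard (P : ℕ → Set) (C : Cycles) : Set where
  field
    ordered  : Ordered C
    unique   : Unique (concat C)
    sound    : ∀ {x} → x ∈ concat C → P x
    complete : ∀ {x} → P x → x ∈ concat C

record CycleFormOf (f : ℕ → ℕ) (P : ℕ → Set) (C : Cycles) : Set where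
  field
    standard : Standard P C
    cycles   : All (IsCycleOf f) C

walk : (ℕ → ℕ) → ℕ → ℕ → ℕ → List ℕ
walk f a zero    x = []
walk f a (suc k) x = if x ≡ᵇ a then [] else x ∷ walk f a k (f x)

-- The helpers `go` of cycleFrom and `loop` of cycleForm are not in scope, but their defining
-- equations hold by refl; abstracting their arguments lets Agda solve G := go (L := loop).
walk-unique : ∀ f a (G : ℕ → ℕ → List ℕ) → (∀ x → G 0 x ≡ []) →
  (∀ k x → G (suc k) x ≡ (if x ≡ᵇ a then [] else x ∷ G k (f x))) → ∀ k x → G k x ≡ walk f a k x
walk-unique f a G G0 Gsuc zero    x = G0 x
walk-unique f a G G0 Gsuc (suc k) x rewrite Gsuc k x with x ≡ᵇ a
... | true  = refl
... | false = cong (x ∷_) (walk-unique f a G G0 Gsuc k (f x))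

cycleFrom≡walk : ∀ π a → cycleFrom π a ≡ a ∷ walk (app π) a (length π) (app π a)
cycleFrom≡walk π a with length π | app π a | walk-unique (app π) a _ (λ _ → refl) (λ _ _ → refl)
... | k | x | G≡walk = cong (a ∷_) (G≡walk k x)

scan : (ℕ → List ℕ) → List ℕ → List ℕ → Cycles
scan c []       seen = []
scan c (a ∷ as) seen = if a ∈ᵇ seen then scan c as seen else c a ∷ scan c as (c a ++ seen)

scan-unique : ∀ (c : ℕ → List ℕ) (L : List ℕ → List ℕ → Cycles) → (∀ seen → L [] seen ≡ []) →
  (∀ a as seen → L (a ∷ as) seen ≡ (if a ∈ᵇ seen then L as seen else c a ∷ L as (c a ++ seen))) →
  ∀ as seen → L as seen ≡ scan c as seen
scan-unique c L L[] L∷ []       seen = L[] seen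
scan-unique c L L[] L∷ (a ∷ as) seen rewrite L∷ a as seen with a ∈ᵇ seen
... | true  = scan-unique c L L[] L∷ as seen
... | false = cong (c a ∷_) (scan-unique c L L[] L∷ as (c a ++ seen))

cycleForm≡scan : ∀ π → cycleForm π ≡ scan (cycleFrom π) (oneTo (length π)) []
cycleForm≡scan π with oneTo (length π) | (List ℕ ∋ []) | scan-unique (cycleFrom π) _ (λ _ → refl) (λ _ _ _ → refl)
... | as | seen | L≡scan = L≡scan as seen

iterate-suc : ∀ (f : ℕ → ℕ) x i → iterate f x (suc i) ≡ f (iterate f x i)
iterate-suc f x zero    = refl
iterate-suc f x (suc i) = iterate-suc f (f x) i

iterate-+ : ∀ (f : ℕ → ℕ) x i k → iterate f (iterate f x i) k ≡ iterate f x (i + k)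
iterate-+ f x zero    k = refl
iterate-+ f x (suc i) k = iterate-+ f (f x) i k

walk≡applyUpTo : ∀ f a e k x → e ≤ k → iterate f x e ≡ a → (∀ {d} → d < e → iterate f x d ≢ a) →
  walk f a k x ≡ applyUpTo (iterate f x) e
walk≡applyUpTo f a zero    zero    x _         _        _     = refl
walk≡applyUpTo f a zero    (suc k) x _         refl     _     = if-T (≡ᵇ-refl x)
walk≡applyUpTo f a (suc e) (suc k) x (s≤s e≤k) returns early rewrite ≢⇒≡ᵇ-false (early (s≤s z≤n)) =
  cong (x ∷_) (walk≡applyUpTo f a e k (f x) e≤k returns (early ∘ s≤s))

edgesFrom-iterate : ∀ f a e x → iterate f x (suc e) ≡ a → All (Edge f) (edgesFrom a x (applyUpTo (iterate f (f x)) e))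
edgesFrom-iterate f a zero    x returns = returns ∷ []
edgesFrom-iterate f a (suc e) x returns = refl ∷ edgesFrom-iterate f a e (f x) returns

record IsOrbit (m : ℕ) (f : ℕ → ℕ) (a : ℕ) (o : List ℕ) : Set where
  field
    cycle   : IsCycleOf f o
    unique  : Unique o
    inRange : ∀ {y} → y ∈ o → InRange m y
    closed  : ∀ {y} → y ∈ o → f y ∈ o
    reaches : ∀ {y} → y ∈ o → ∃ λ k → iterate f y k ≡ a

module Orbit {m : ℕ} {f : ℕ → ℕ}
  (f-inRange : ∀ {x} → InRange m x → InRange m (f x))
  (f-injective : ∀ {x y} → InRange m x → InRange m y → f x ≡ f y → x ≡ y)
  {a : ℕ} (a∈ : InRange m a) where

  NoReturnBefore : ℕ → Set
  NoReturnBefore r = ∀ {d} → 1 ≤ d → d < r → iterate f a d ≢ a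

  iterate-inRange : ∀ i {x} → InRange m x → InRange m (iterate f x i)
  iterate-inRange zero    x∈ = x∈
  iterate-inRange (suc i) x∈ = iterate-inRange i (f-inRange x∈)

  distinct : ∀ {r} → NoReturnBefore r → ∀ {i j} → i < j → j < r → iterate f a i ≢ iterate f a j
  distinct noReturn {zero}  {suc j} _         j<r eq = noReturn (s≤s z≤n) j<r (sym eq)
  distinct noReturn {suc i} {suc j} (s≤s i<j) j<r eq =
    distinct noReturn i<j (<-trans (n<1+n j) j<r)
      (f-injective (iterate-inRange i a∈) (iterate-inRange j a∈)
        (trans (sym (iterate-suc f a i)) (trans eq (iterate-suc f a j))))

  extend : ∀ {r} → NoReturnBefore r → iterate f a r ≢ a → NoReturnBefore (suc r)
  extend noReturn ¬ret 1≤d d<1+r with m≤n⇒m<n∨m≡n (≤-pred d<1+r)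
  ... | inj₁ d<r  = noReturn 1≤d d<r
  ... | inj₂ refl = ¬ret

  FirstReturn : ℕ → Set
  FirstReturn r′ = iterate f a (suc r′) ≡ a × NoReturnBefore (suc r′)

  firstReturn : ∀ B → NoReturnBefore (suc B) ⊎ Σ ℕ λ r′ → suc r′ ≤ B × FirstReturn r′
  firstReturn zero = inj₁ (λ 1≤d d<1 → contradiction 1≤d (<⇒≱ d<1))
  firstReturn (suc B) with firstReturn B
  ... | inj₂ (r′ , r≤B , first) = inj₂ (r′ , m≤n⇒m≤1+n r≤B , first)
  ... | inj₁ noReturn with iterate f a (suc B) ≟ a
  ...   | yes ret = inj₂ (B , ≤-refl , ret , noReturn)
  ...   | no ¬ret = inj₁ (extend noReturn ¬ret)

  -- pigeonhole: the m + 1 distinct letters a, f a, …, fᵐ a cannot all lie in [1, m]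
  period : Σ ℕ λ r′ → suc r′ ≤ m × FirstReturn r′
  period with firstReturn m
  ... | inj₂ found    = found
  ... | inj₁ noReturn = contradiction
    (subst₂ _≤_ (length-applyUpTo (iterate f a) (suc m)) (length-oneTo m)
      (Unique⇒length≤ (Unique.applyUpTo⁺₁ (iterate f a) (suc m) (distinct noReturn)) ⊆oneTo))
    1+n≰n
    where
    ⊆oneTo : ∀ {y} → y ∈ applyUpTo (iterate f a) (suc m) → y ∈ oneTo m
    ⊆oneTo y∈ with i , _ , refl ← ∈-applyUpTo⁻ (iterate f a) y∈ = ∈-oneTo⁺ m (iterate-inRange i a∈)

  r′ : ℕ
  r′ = proj₁ period

  r≤m : suc r′ ≤ m
  r≤m = proj₁ (proj₂ period)

  returns : iterate f a (suc r′) ≡ a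
  returns = proj₁ (proj₂ (proj₂ period))

  first : NoReturnBefore (suc r′)
  first = proj₂ (proj₂ (proj₂ period))

  orbit : List ℕ
  orbit = applyUpTo (iterate f a) (suc r′)

  isOrbit : IsOrbit m f a orbit
  isOrbit = record
    { cycle   = edgesFrom-iterate f a r′ a returns
    ; unique  = Unique.applyUpTo⁺₁ (iterate f a) (suc r′) (distinct first)
    ; inRange = λ y∈ → let (i , _ , y≡) = ∈-applyUpTo⁻ (iterate f a) y∈ in
                       subst (InRange m) (sym y≡) (iterate-inRange i a∈)
    ; closed  = closed
    ; reaches = reaches
    }
    where
    closed : ∀ {y} → y ∈ orbit → f y ∈ orbit
    closed y∈ with i , i<r , refl ← ∈-applyUpTo⁻ (iterate f a) y∈ with m≤n⇒m<n∨m≡n i<r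
    ... | inj₁ 1+i<r = subst (_∈ orbit) (iterate-suc f a i) (∈-applyUpTo⁺ (iterate f a) 1+i<r)
    ... | inj₂ refl  = subst (_∈ orbit) (trans (sym returns) (iterate-suc f a r′)) (here refl)
    reaches : ∀ {y} → y ∈ orbit → ∃ λ k → iterate f y k ≡ a
    reaches y∈ with i , i<r , refl ← ∈-applyUpTo⁻ (iterate f a) y∈ =
      suc r′ ∸ i , trans (iterate-+ f a i (suc r′ ∸ i)) (trans (cong (iterate f a) (m+[n∸m]≡n (<⇒≤ i<r))) returns)

Standard-⇔ : ∀ {P Q : ℕ → Set} {C} → (∀ {x} → P x → Q x) → (∀ {x} → Q x → P x) → Standard P C → Standard Q C
Standard-⇔ P⇒Q Q⇒P std = record
  { ordered = ordered ; unique = unique ; sound = P⇒Q ∘ sound ; complete = complete ∘ Q⇒P }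
  where open Standard std

letters≤ : ∀ {n C} → Standard (InRange n) C → All (_≤ n) (concat C)
letters≤ std = All.tabulate (proj₂ ∘ Standard.sound std)

Standard-∷ : ∀ {P : ℕ → Set} {h t Cs} → Standard P Cs → All (h <_) t → All (h <_) (concat Cs) → Unique (h ∷ t) →
  (∀ {x} → x ∈ h ∷ t → ¬ P x) → Standard (λ x → x ∈ h ∷ t ⊎ P x) ((h ∷ t) ∷ Cs)
Standard-∷ {h = h} {t} std h<t h<Cs u disjoint = record
  { ordered  = h<t , h<Cs , ordered
  ; unique   = Unique.++⁺ u unique (λ (x∈ , x∈Cs) → disjoint x∈ (sound x∈Cs))
  ; sound    = λ x∈ → Sum.map₂ sound (∈-++⁻ (h ∷ t) x∈)
  ; complete = λ { (inj₁ x∈) → ∈-++⁺ˡ x∈ ; (inj₂ px) → ∈-++⁺ʳ (h ∷ t) (complete px) }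
  }
  where open Standard std

interval : ℕ → ℕ → List ℕ
interval a zero    = []
interval a (suc n) = a ∷ interval (suc a) n

oneTo≡interval : ∀ m → oneTo m ≡ interval 1 m
oneTo≡interval m = trans (oneTo≡applyUpTo m) (applyUpTo-+ 0 m)
  where
  applyUpTo-+ : ∀ a n → applyUpTo (λ i → suc (a + i)) n ≡ interval (suc a) n
  applyUpTo-+ a zero    = refl
  applyUpTo-+ a (suc n) = cong₂ _∷_ (cong suc (+-identityʳ a))
    (trans (applyUpTo-cong (λ i → cong suc (+-suc a i)) n) (applyUpTo-+ (suc a) n))
    where
    applyUpTo-cong : ∀ {f g : ℕ → ℕ} → (∀ i → f i ≡ g i) → ∀ n → applyUpTo f n ≡ applyUpTo g n
    applyUpTo-cong f≗g zero    = refl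
    applyUpTo-cong f≗g (suc n) = cong₂ _∷_ (f≗g 0) (applyUpTo-cong (f≗g ∘ suc) n)

∈ᵇ⇒∈ : ∀ {a} s → T (a ∈ᵇ s) → a ∈ s
∈ᵇ⇒∈ {a} s a∈ᵇs = Any.map (≡ᵇ⇒≡ a _) (any⁻ (a ≡ᵇ_) s a∈ᵇs)

∈⇒∈ᵇ : ∀ {a s} → a ∈ s → T (a ∈ᵇ s)
∈⇒∈ᵇ {a} a∈s = any⁺ (a ≡ᵇ_) (Any.map (≡⇒≡ᵇ a _) a∈s)

module Scan {m : ℕ} {f : ℕ → ℕ} {c : ℕ → List ℕ}
  (orbitOf : ∀ {a} → InRange m a → ∃ λ t → c a ≡ a ∷ t × IsOrbit m f a (a ∷ t)) where

  Closed : List ℕ → Set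
  Closed s = ∀ {x} → x ∈ s → f x ∈ s

  iterate-closed : ∀ {s} → Closed s → ∀ k {y} → y ∈ s → iterate f y k ∈ s
  iterate-closed closed zero    y∈ = y∈
  iterate-closed closed (suc k) y∈ = iterate-closed closed k (closed y∈)

  Unseen : List ℕ → ℕ → Set
  Unseen seen x = InRange m x × x ∉ seen

  prepend-orbit : ∀ {a t seen rest} → IsOrbit m f a (a ∷ t) → a ∉ seen → Closed seen →
    (∀ {x} → 1 ≤ x → x < a → x ∈ seen) → CycleFormOf f (Unseen ((a ∷ t) ++ seen)) rest →
    CycleFormOf f (Unseen seen) ((a ∷ t) ∷ rest)
  prepend-orbit {a} {t} {seen} isOrbit a∉seen seen-closed below F = record
    { standard = Standard-⇔ into outof (Standard-∷ (standard F) (All.tabulate a<t)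
                   (All.tabulate λ y∈ → let (y∈m , y∉) = sound (standard F) y∈ in
                      above y∈m (y∉ ∘ ∈-++⁺ʳ o) (λ { refl → y∉ (here refl) }))
                   unique (λ x∈ (_ , x∉) → x∉ (∈-++⁺ˡ x∈)))
    ; cycles   = cycle ∷ cycles F }
    where
    open IsOrbit isOrbit
    open CycleFormOf using (standard; cycles)
    open Standard using (sound)
    o = a ∷ t
    orbit-unseen : ∀ {y} → y ∈ o → y ∉ seen
    orbit-unseen y∈ y∈seen = let (k , ret) = reaches y∈ in
      a∉seen (subst (_∈ seen) ret (iterate-closed seen-closed k y∈seen))
    above : ∀ {y} → InRange m y → y ∉ seen → y ≢ a → a < y
    above {y} y∈ y∉ y≢a with y <? a
    ... | yes y<a = contradiction (below (proj₁ y∈) y<a) y∉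
    ... | no  y≮a = ≤∧≢⇒< (≮⇒≥ y≮a) (y≢a ∘ sym)
    a<t : ∀ {y} → y ∈ t → a < y
    a<t y∈ = above (inRange (there y∈)) (orbit-unseen (there y∈)) λ { refl → Unique[x∷xs]⇒x∉xs unique y∈ }
    into : ∀ {x} → x ∈ o ⊎ Unseen (o ++ seen) x → Unseen seen x
    into (inj₁ x∈)        = inRange x∈ , orbit-unseen x∈
    into (inj₂ (x∈m , x∉)) = x∈m , x∉ ∘ ∈-++⁺ʳ o
    outof : ∀ {x} → Unseen seen x → x ∈ o ⊎ Unseen (o ++ seen) x
    outof {x} (x∈m , x∉) with x ∈? o
    ... | yes x∈o = inj₁ x∈o
    ... | no  x∉o = inj₂ (x∈m , [ x∉o , x∉ ]′ ∘ ∈-++⁻ o)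

  -- Invariant: every letter below a has been seen, so an unseen a is the least letter of its cycle.
  scan-correct : ∀ n a seen → a + n ≡ suc m → 1 ≤ a → Closed seen → (∀ {x} → 1 ≤ x → x < a → x ∈ seen) →
    (∀ {x} → x ∈ seen → InRange m x) → CycleFormOf f (Unseen seen) (scan c (interval a n) seen)
  scan-correct zero a seen a+0≡ _ _ below _ = record
    { standard = record
      { ordered = tt ; unique = [] ; sound = λ ()
      ; complete = λ (x∈ , x∉) → contradiction (below (proj₁ x∈) (subst (_ <_) a≡ (s≤s (proj₂ x∈)))) x∉ }
    ; cycles = [] }
    where a≡ = trans (sym a+0≡) (+-identityʳ a)
  scan-correct (suc n) a seen a+n≡ 1≤a seen-closed below seen⊆ with a ∈ᵇ seen in a∈ᵇ
  ... | true = scan-correct n (suc a) seen (trans (sym (+-suc a n)) a+n≡) (s≤s z≤n) seen-closed below′ seen⊆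
    where
    below′ : ∀ {x} → 1 ≤ x → x < suc a → x ∈ seen
    below′ 1≤x x<1+a with m≤n⇒m<n∨m≡n (≤-pred x<1+a)
    ... | inj₁ x<a  = below 1≤x x<a
    ... | inj₂ refl = ∈ᵇ⇒∈ seen (subst T (sym a∈ᵇ) tt)
  ... | false with orbitOf (1≤a , ≤-pred (subst (a <_) a+n≡ (m<m+n a (s≤s z≤n))))
  ...   | t , c≡ , isOrbit rewrite c≡ =
    prepend-orbit isOrbit (λ a∈ → subst T a∈ᵇ (∈⇒∈ᵇ a∈)) seen-closed below
      (scan-correct n (suc a) (o ++ seen) (trans (sym (+-suc a n)) a+n≡) (s≤s z≤n)
        (λ x∈ → [ ∈-++⁺ˡ ∘ closed , ∈-++⁺ʳ o ∘ seen-closed ]′ (∈-++⁻ o x∈))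
        (λ 1≤x x<1+a → case m≤n⇒m<n∨m≡n (≤-pred x<1+a) of λ
           { (inj₁ x<a) → ∈-++⁺ʳ o (below 1≤x x<a) ; (inj₂ refl) → here refl })
        (λ x∈ → [ inRange , seen⊆ ]′ (∈-++⁻ o x∈)))
    where
    open IsOrbit isOrbit using (closed; inRange)
    o = a ∷ t

cycleForm-correct : ∀ {m π} → π ∈ S m → CycleFormOf (app π) (InRange m) (cycleForm π)
cycleForm-correct {m} {π} π∈S = record
  { standard = Standard-⇔ proj₁ (λ x∈ → x∈ , λ ()) (standard scanned)
  ; cycles   = cycles scanned }
  where
  open CycleFormOf
  orbitOf : ∀ {a} → InRange m a → ∃ λ t → cycleFrom π a ≡ a ∷ t × IsOrbit m (app π) a (a ∷ t)
  orbitOf {a} a∈ = applyUpTo (iterate (app π) (app π a)) r′ , cycleFrom≡orbit , isOrbit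
    where
    open Orbit (∈S⇒app-inRange π∈S) (∈S⇒app-injective π∈S) a∈
    cycleFrom≡orbit : cycleFrom π a ≡ orbit
    cycleFrom≡orbit = trans (cycleFrom≡walk π a) (cong (a ∷_)
      (walk≡applyUpTo (app π) a r′ (length π) (app π a) (≤-trans (n≤1+n r′) (subst (suc r′ ≤_) (sym (∈S⇒length π∈S)) r≤m))
        returns (λ d<r′ → first (s≤s z≤n) (s≤s d<r′))))
  open Scan orbitOf
  scanned : CycleFormOf (app π) (Unseen []) (cycleForm π)
  scanned = subst (CycleFormOf (app π) (Unseen []))
    (sym (trans (cycleForm≡scan π) (cong (λ as → scan (cycleFrom π) as []) oneTo≡)))
    (scan-correct m 1 [] refl (s≤s z≤n) (λ ()) (λ 1≤x x<1 → contradiction 1≤x (<⇒≱ x<1)) (λ ()))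
    where oneTo≡ = trans (cong oneTo (∈S⇒length π∈S)) (oneTo≡interval m)

open CycleFormOf
open Standard

-- A permutation is determined by its cycle form

Ordered-head≤ : ∀ {h t Cs} → Ordered ((h ∷ t) ∷ Cs) → ∀ {x} → x ∈ concat ((h ∷ t) ∷ Cs) → h ≤ x
Ordered-head≤ _               (here refl) = ≤-refl
Ordered-head≤ {t = t} (h<t , h<Cs , _) (there x∈) =
  <⇒≤ ([ All.lookup h<t , All.lookup h<Cs ]′ (∈-++⁻ t x∈))

Standard-tail : ∀ {P : ℕ → Set} {c Cs} → Standard P (c ∷ Cs) → Standard (λ x → P x × x ∉ c) Cs
Standard-tail {c = []}    std = ⊥-elim (ordered std)
Standard-tail {c = h ∷ t} std = record
  { ordered  = proj₂ (proj₂ (ordered std))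
  ; unique   = uCs
  ; sound    = λ x∈ → sound std (∈-++⁺ʳ (h ∷ t) x∈) , λ x∈c → disjoint x∈c x∈
  ; complete = λ (px , x∉c) → [ flip contradiction x∉c , id ]′ (∈-++⁻ (h ∷ t) (complete std px)) }
  where
  uCs = proj₁ (proj₂ (Unique-++⁻ (h ∷ t) (unique std)))
  disjoint = proj₂ (proj₂ (Unique-++⁻ (h ∷ t) (unique std)))

edgesFrom-functional : ∀ {f} h x t t′ → All (Edge f) (edgesFrom h x t) → All (Edge f) (edgesFrom h x t′) →
  h ∉ t → h ∉ t′ → t ≡ t′
edgesFrom-functional h x []      []        _        _          _   _    = refl
edgesFrom-functional h x []      (y′ ∷ t′) (e ∷ _)  (e′ ∷ _)   _   h∉t′ = contradiction (here (trans (sym e) e′)) h∉t′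
edgesFrom-functional h x (y ∷ t) []        (e ∷ _)  (e′ ∷ _)   h∉t _    = contradiction (here (trans (sym e′) e)) h∉t
edgesFrom-functional h x (y ∷ t) (y′ ∷ t′) (e ∷ es) (e′ ∷ es′) h∉t h∉t′ with refl ← trans (sym e) e′ =
  cong (y ∷_) (edgesFrom-functional h y t t′ es es′ (h∉t ∘ there) (h∉t′ ∘ there))

-- The least letter heads the first cycle, and f then forces the rest of that cycle.
CycleFormOf-unique : ∀ {f P} C C′ → CycleFormOf f P C → CycleFormOf f P C′ → C ≡ C′
CycleFormOf-unique []              []                _ _  = refl
CycleFormOf-unique []              ([] ∷ _)          _ F′ = ⊥-elim (ordered (standard F′))
CycleFormOf-unique []              ((h′ ∷ _) ∷ _)    F F′ with () ← complete (standard F) (sound (standard F′) (here refl))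
CycleFormOf-unique ([] ∷ _)        _                 F _  = ⊥-elim (ordered (standard F))
CycleFormOf-unique ((h ∷ _) ∷ _)   []                F F′ with () ← complete (standard F′) (sound (standard F) (here refl))
CycleFormOf-unique (_ ∷ _)         ([] ∷ _)          _ F′ = ⊥-elim (ordered (standard F′))
CycleFormOf-unique ((h ∷ t) ∷ C)   ((h′ ∷ t′) ∷ C′)  F F′
  with refl ← ≤-antisym (Ordered-head≤ (ordered (standard F)) (complete (standard F) (sound (standard F′) (here refl))))
                        (Ordered-head≤ (ordered (standard F′)) (complete (standard F′) (sound (standard F) (here refl))))
  with refl ← edgesFrom-functional h h t t′ (All.head (cycles F)) (All.head (cycles F′))
                (Unique[x∷xs]⇒x∉xs (proj₁ (Unique-++⁻ (h ∷ t) (unique (standard F)))))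
                (Unique[x∷xs]⇒x∉xs (proj₁ (Unique-++⁻ (h ∷ t′) (unique (standard F′)))))
  = cong ((h ∷ t) ∷_) (CycleFormOf-unique C C′ (tail F) (tail F′))
  where
  tail : ∀ {f P c Cs} → CycleFormOf f P (c ∷ Cs) → CycleFormOf f (λ x → P x × x ∉ c) Cs
  tail F = record { standard = Standard-tail (standard F) ; cycles = All.tail (cycles F) }

edges : List ℕ → List (ℕ × ℕ)
edges []      = []
edges (h ∷ t) = edgesFrom h h t

allEdges : Cycles → List (ℕ × ℕ)
allEdges = concatMap edges

lookupEdge : List (ℕ × ℕ) → ℕ → ℕ
lookupEdge []            x = 0
lookupEdge ((a , b) ∷ es) x = if x ≡ᵇ a then b else lookupEdge es x

successor : Cycles → ℕ → ℕ
successor C = lookupEdge (allEdges C)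

fromCycles : ℕ → Cycles → List ℕ
fromCycles m C = map (successor C) (oneTo m)

lookupEdge-∈ : ∀ es {x y} → Unique (map proj₁ es) → (x , y) ∈ es → lookupEdge es x ≡ y
lookupEdge-∈ ((a , b) ∷ es) _ (here refl) = if-T (≡ᵇ-refl a)
lookupEdge-∈ ((a , b) ∷ es) {x} (a∉ ∷ u) (there xy∈)
  rewrite ≢⇒≡ᵇ-false {x} {a} (λ { refl → All.lookup a∉ (∈-map⁺ proj₁ xy∈) refl }) = lookupEdge-∈ es u xy∈

sources-edgesFrom : ∀ h x t → map proj₁ (edgesFrom h x t) ≡ x ∷ t
sources-edgesFrom h x []      = refl
sources-edgesFrom h x (y ∷ t) = cong (x ∷_) (sources-edgesFrom h y t)

targets-edgesFrom : ∀ h x t → map proj₂ (edgesFrom h x t) ≡ t ∷ʳ h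
targets-edgesFrom h x []      = refl
targets-edgesFrom h x (y ∷ t) = cong (y ∷_) (targets-edgesFrom h y t)

sources-allEdges : ∀ C → map proj₁ (allEdges C) ≡ concat C
sources-allEdges []            = refl
sources-allEdges ([] ∷ C)      = sources-allEdges C
sources-allEdges ((h ∷ t) ∷ C) =
  trans (map-++ proj₁ (edgesFrom h h t) (allEdges C)) (cong₂ _++_ (sources-edgesFrom h h t) (sources-allEdges C))

targets-allEdges : ∀ C → map proj₂ (allEdges C) ↭ concat C
targets-allEdges []            = ↭-refl
targets-allEdges ([] ∷ C)      = targets-allEdges C
targets-allEdges ((h ∷ t) ∷ C) = subst (_↭ concat ((h ∷ t) ∷ C)) (sym (map-++ proj₂ (edgesFrom h h t) (allEdges C)))
  (++⁺ (subst (_↭ h ∷ t) (sym (targets-edgesFrom h h t)) (↭-sym (∷↭∷ʳ h t))) (targets-allEdges C))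

targets-injective : ∀ (es : List (ℕ × ℕ)) {x y z} → Unique (map proj₂ es) → (x , z) ∈ es → (y , z) ∈ es → x ≡ y
targets-injective (e ∷ es) _        (here refl) (here refl) = refl
targets-injective (e ∷ es) (e∉ ∷ _) (here refl) (there yz∈) = contradiction (∈-map⁺ proj₂ yz∈) (λ z∈ → All.lookup e∉ z∈ refl)
targets-injective (e ∷ es) (e∉ ∷ _) (there xz∈) (here refl) = contradiction (∈-map⁺ proj₂ xz∈) (λ z∈ → All.lookup e∉ z∈ refl)
targets-injective (e ∷ es) (_ ∷ u)  (there xz∈) (there yz∈) = targets-injective es u xz∈ yz∈

module FromCycles {m : ℕ} {C : Cycles} (std : Standard (InRange m) C) where

  private
    es = allEdges C
    sources-unique : Unique (map proj₁ es)
    sources-unique = subst Unique (sym (sources-allEdges C)) (unique std)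
    targets-unique : Unique (map proj₂ es)
    targets-unique = Unique-resp-↭ (↭-sym (targets-allEdges C)) (unique std)

  successor-edge : ∀ {x} → x ∈ concat C → (x , successor C x) ∈ es
  successor-edge x∈ with (a , b) , e∈ , refl ← ∈-map⁻ proj₁ (subst (_ ∈_) (sym (sources-allEdges C)) x∈) =
    subst (λ z → (a , z) ∈ es) (sym (lookupEdge-∈ es sources-unique e∈)) e∈

  source∈ : ∀ {x y} → (x , y) ∈ es → x ∈ concat C
  source∈ e∈ = subst (_ ∈_) (sources-allEdges C) (∈-map⁺ proj₁ e∈)

  successor-inRange : ∀ {x} → InRange m x → InRange m (successor C x)
  successor-inRange x∈ = sound std (∈-resp-↭ (targets-allEdges C) (∈-map⁺ proj₂ (successor-edge (complete std x∈))))

  fromCycles-↭ : fromCycles m C ↭ oneTo m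
  fromCycles-↭ = ∼bag⇒↭ (unique∧set⇒bag fromCycles-unique (oneTo-unique m) (mk⇔ ⊆ ⊇))
    where
    fromCycles-unique : Unique (fromCycles m C)
    fromCycles-unique = Unique-map⁺ (successor C) (oneTo-unique m) λ x∈ y∈ eq →
      targets-injective es targets-unique (successor-edge (complete std (∈-oneTo⁻ m x∈)))
        (subst (λ z → (_ , z) ∈ es) (sym eq) (successor-edge (complete std (∈-oneTo⁻ m y∈))))
    ⊆ : ∀ {y} → y ∈ fromCycles m C → y ∈ oneTo m
    ⊆ y∈ with x , x∈ , refl ← ∈-map⁻ (successor C) y∈ = ∈-oneTo⁺ m (successor-inRange (∈-oneTo⁻ m x∈))
    ⊇ : ∀ {y} → y ∈ oneTo m → y ∈ fromCycles m C
    ⊇ y∈ with (x , z) , e∈ , refl ← ∈-map⁻ proj₂ (∈-resp-↭ (↭-sym (targets-allEdges C)) (complete std (∈-oneTo⁻ m y∈))) =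
      subst (_∈ fromCycles m C) (lookupEdge-∈ es sources-unique e∈)
        (∈-map⁺ (successor C) (∈-oneTo⁺ m (sound std (source∈ e∈))))

  fromCycles-∈S : fromCycles m C ∈ S m
  fromCycles-∈S = ∈-arrangements⁺ (oneTo m) fromCycles-↭

  app-fromCycles : ∀ {x} → InRange m x → app (fromCycles m C) x ≡ successor C x
  app-fromCycles = app-map-oneTo (successor C) m

  cycleForm-fromCycles : cycleForm (fromCycles m C) ≡ C
  cycleForm-fromCycles = CycleFormOf-unique _ C (cycleForm-correct fromCycles-∈S)
    record { standard = std ; cycles = cycles-of C (ordered std) (λ e∈ → e∈) }
    where
    cycles-of : ∀ D → Ordered D → (∀ {e} → e ∈ allEdges D → e ∈ es) → All (IsCycleOf (app (fromCycles m C))) D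
    cycles-of []            _         _    = []
    cycles-of ((h ∷ t) ∷ D) (_ , _ , ord) ⊆es =
      All.tabulate (λ e∈ → let e∈es = ⊆es (∈-++⁺ˡ e∈) in
        trans (app-fromCycles (sound std (source∈ e∈es))) (lookupEdge-∈ es sources-unique e∈es))
      ∷ cycles-of D ord (⊆es ∘ ∈-++⁺ʳ (edgesFrom h h t))

  successor-agrees : ∀ {f} → All (IsCycleOf f) C → ∀ {x} → x ∈ concat C → f x ≡ successor C x
  successor-agrees {f} cyc x∈ = All.lookup (edges-of C (ordered std) cyc) (successor-edge x∈)
    where
    edges-of : ∀ D → Ordered D → All (IsCycleOf f) D → All (Edge f) (allEdges D)
    edges-of []            _             []         = []
    edges-of ((h ∷ t) ∷ D) (_ , _ , ord) (c ∷ cyc) = All-++⁺ c (edges-of D ord cyc)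

fromCycles-cycleForm : ∀ {m π} → π ∈ S m → fromCycles m (cycleForm π) ≡ π
fromCycles-cycleForm {m} {π} π∈S =
  app-ext (fromCycles m C) π (trans length≡ (sym (∈S⇒length π∈S))) λ x∈ →
    let x∈m = subst (λ k → InRange k _) length≡ x∈ in
    trans (app-fromCycles x∈m) (sym (successor-agrees (cycles F) (complete (standard F) x∈m)))
  where
  C = cycleForm π
  F = cycleForm-correct π∈S
  open FromCycles (standard F)
  length≡ : length (fromCycles m C) ≡ m
  length≡ = trans (length-map (successor C) (oneTo m)) (length-oneTo m)

-- The pattern 12-3

Avoids : List ℕ → Set
Avoids w = contains12-3 w ≡ false

StrictlyMonotoneOn : (ℕ → Set) → (ℕ → ℕ) → Set
StrictlyMonotoneOn P g = ∀ {x y} → P x → P y → x < y → g x < g y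

strictlyMonotone⇒<ᵇ : ∀ {P g} → StrictlyMonotoneOn P g → ∀ {x y} → P x → P y → (g x <ᵇ g y) ≡ (x <ᵇ y)
strictlyMonotone⇒<ᵇ {g = g} mono {x} {y} px py = T-⇔⇒≡
  (λ gx<ᵇgy → <⇒<ᵇ (≰⇒> λ y≤x → not-below y≤x (<ᵇ⇒< (g x) (g y) gx<ᵇgy)))
  (λ x<ᵇy → <⇒<ᵇ (mono px py (<ᵇ⇒< x y x<ᵇy)))
  where
  not-below : y ≤ x → ¬ g x < g y
  not-below y≤x gx<gy with m≤n⇒m<n∨m≡n y≤x
  ... | inj₁ y<x  = <-asym gx<gy (mono py px y<x)
  ... | inj₂ refl = <-irrefl refl gx<gy

avoids-tail : ∀ a w → Avoids (a ∷ w) → Avoids w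
avoids-tail a []            _      = refl
avoids-tail a (b ∷ rest) avoids = ∨-conicalʳ _ _ avoids

any<ᵇ-false⇒≤ : ∀ b rest → any (b <ᵇ_) rest ≡ false → All (_≤ b) rest
any<ᵇ-false⇒≤ b rest none = All.tabulate λ y∈ → ≮⇒≥ λ b<y →
  subst T none (any⁺ (b <ᵇ_) (lose y∈ (<⇒<ᵇ b<y)))

≤⇒any<ᵇ-false : ∀ b rest → All (_≤ b) rest → any (b <ᵇ_) rest ≡ false
≤⇒any<ᵇ-false b []         []          = refl
≤⇒any<ᵇ-false b (y ∷ rest) (y≤b ∷ ≤b) rewrite ≥⇒<ᵇ-false y≤b = ≤⇒any<ᵇ-false b rest ≤b

avoids-ascent : ∀ {a b} rest → a < b → Avoids (a ∷ b ∷ rest) → All (_≤ b) rest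
avoids-ascent {a} {b} rest a<b avoids with a <ᵇ b | <⇒<ᵇ a<b
... | true | _ = any<ᵇ-false⇒≤ b rest (∨-conicalˡ _ _ avoids)

contains12-3-skip-max : ∀ a {b} rest → All (_≤ b) rest → contains12-3 (a ∷ b ∷ rest) ≡ contains12-3 (b ∷ rest)
contains12-3-skip-max a {b} rest ≤b rewrite ≤⇒any<ᵇ-false b rest ≤b | ∧-zeroʳ (a <ᵇ b) = refl

contains12-3-skip-descent : ∀ {a b} rest → b < a → contains12-3 (a ∷ b ∷ rest) ≡ contains12-3 (b ∷ rest)
contains12-3-skip-descent rest b<a rewrite ≥⇒<ᵇ-false (<⇒≤ b<a) = refl

contains12-3-drop-middle : ∀ a {b i c} r → All (_≤ b) (i ∷ c ∷ r) → i < b → c < i →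
  contains12-3 (a ∷ b ∷ i ∷ c ∷ r) ≡ contains12-3 (a ∷ b ∷ c ∷ r)
contains12-3-drop-middle a {b} {i} {c} r ≤b i<b c<i = begin
  contains12-3 (a ∷ b ∷ i ∷ c ∷ r) ≡⟨ contains12-3-skip-max a (i ∷ c ∷ r) ≤b ⟩
  contains12-3 (b ∷ i ∷ c ∷ r)     ≡⟨ contains12-3-skip-descent (c ∷ r) i<b ⟩
  contains12-3 (i ∷ c ∷ r)         ≡⟨ contains12-3-skip-descent r c<i ⟩
  contains12-3 (c ∷ r)             ≡⟨ contains12-3-skip-descent r (<-trans c<i i<b) ⟨
  contains12-3 (b ∷ c ∷ r)         ≡⟨ contains12-3-skip-max a (c ∷ r) (All.tail ≤b) ⟨
  contains12-3 (a ∷ b ∷ c ∷ r)     ∎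
  where open ≡-Reasoning

contains12-3-map : ∀ g w → (∀ {x y} → x ∈ w → y ∈ w → (g x <ᵇ g y) ≡ (x <ᵇ y)) → contains12-3 (map g w) ≡ contains12-3 w
contains12-3-map g []             _   = refl
contains12-3-map g (a ∷ [])       _   = refl
contains12-3-map g (a ∷ b ∷ rest) <ᵇ≡ =
  cong₂ _∨_ (cong₂ _∧_ (<ᵇ≡ (here refl) (there (here refl))) (any-map rest (λ y∈ → <ᵇ≡ (there (here refl)) (there (there y∈)))))
            (contains12-3-map g (b ∷ rest) (λ x∈ y∈ → <ᵇ≡ (there x∈) (there y∈)))
  where
  any-map : ∀ rest → (∀ {y} → y ∈ rest → (g b <ᵇ g y) ≡ (b <ᵇ y)) → any (g b <ᵇ_) (map g rest) ≡ any (b <ᵇ_) rest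
  any-map []         _   = refl
  any-map (y ∷ rest) <ᵇ≡ = cong₂ _∨_ (<ᵇ≡ (here refl)) (any-map rest (<ᵇ≡ ∘ there))

-- Order-preserving relabelling

-- punchIn i : [1, m] → [1, m + 1] ∖ {i} is the order-preserving bijection; punchOut i inverts it
punchIn : ℕ → ℕ → ℕ
punchIn i x = if x <ᵇ i then x else suc x

punchOut : ℕ → ℕ → ℕ
punchOut i x = if x <ᵇ i then x else x ∸ 1

punchIn-< : ∀ {i x} → x < i → punchIn i x ≡ x
punchIn-< x<i = if-T (<⇒<ᵇ x<i)

punchIn-≥ : ∀ {i x} → i ≤ x → punchIn i x ≡ suc x
punchIn-≥ i≤x rewrite ≥⇒<ᵇ-false i≤x = refl

punchOut-< : ∀ {i x} → x < i → punchOut i x ≡ x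
punchOut-< x<i = if-T (<⇒<ᵇ x<i)

punchOut-≥ : ∀ {i x} → i ≤ x → punchOut i x ≡ x ∸ 1
punchOut-≥ i≤x rewrite ≥⇒<ᵇ-false i≤x = refl

punchOut-punchIn : ∀ {i x} → punchOut i (punchIn i x) ≡ x
punchOut-punchIn {i} {x} with x <? i
... | yes x<i rewrite punchIn-< x<i = punchOut-< x<i
... | no  x≮i rewrite punchIn-≥ (≮⇒≥ x≮i) = punchOut-≥ {i} {suc x} (m≤n⇒m≤1+n (≮⇒≥ x≮i))

punchIn-punchOut : ∀ {i x} → x ≢ i → punchIn i (punchOut i x) ≡ x
punchIn-punchOut {i} {x} x≢i with x <? i
... | yes x<i rewrite punchOut-< x<i = punchIn-< x<i
... | no  x≮i with x | ≤∧≢⇒< (≮⇒≥ x≮i) (x≢i ∘ sym) | punchOut-≥ {i} {x} (≮⇒≥ x≮i)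
...   | suc x′ | s≤s i≤x′ | eq rewrite eq = punchIn-≥ {i} {x′} i≤x′

punchIn-mono : ∀ i {x y} → x < y → punchIn i x < punchIn i y
punchIn-mono i {x} {y} x<y with x <? i | y <? i
... | yes x<i | yes y<i rewrite punchIn-< x<i | punchIn-< y<i = x<y
... | yes x<i | no  y≮i rewrite punchIn-< x<i | punchIn-≥ (≮⇒≥ y≮i) = m≤n⇒m≤1+n x<y
... | no  x≮i | yes y<i = contradiction (<-trans x<y y<i) x≮i
... | no  x≮i | no  y≮i rewrite punchIn-≥ (≮⇒≥ x≮i) | punchIn-≥ (≮⇒≥ y≮i) = s≤s x<y

punchOut-mono : ∀ i {x y} → x ≢ i → y ≢ i → x < y → punchOut i x < punchOut i y
punchOut-mono i {x} {y} x≢i y≢i x<y with x <? i | y <? i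
... | yes x<i | yes y<i rewrite punchOut-< x<i | punchOut-< y<i = x<y
... | yes x<i | no  y≮i rewrite punchOut-< x<i | punchOut-≥ (≮⇒≥ y≮i) =
  <-≤-trans x<i (pred-mono-≤ (≤∧≢⇒< (≮⇒≥ y≮i) (y≢i ∘ sym)))
... | no  x≮i | yes y<i = contradiction (<-trans x<y y<i) x≮i
... | no  x≮i | no  y≮i rewrite punchOut-≥ (≮⇒≥ x≮i) | punchOut-≥ (≮⇒≥ y≮i) =
  ∸-monoˡ-< x<y (≤-trans (s≤s z≤n) (≤∧≢⇒< (≮⇒≥ x≮i) (x≢i ∘ sym)))

InRangeExcept : ℕ → ℕ → ℕ → Set
InRangeExcept m i x = InRange m x × x ≢ i

inRange-split : ∀ {n x} i → InRange n x → x ≡ i ⊎ InRangeExcept n i x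
inRange-split {x = x} i x∈ with x ≟ i
... | yes x≡i = inj₁ x≡i
... | no  x≢i = inj₂ (x∈ , x≢i)

inRange-splitTop : ∀ {m x} → InRange (suc m) x → x ≡ suc m ⊎ InRange m x
inRange-splitTop {m} x∈@(1≤x , x≤1+m) =
  Sum.map₂ (λ (_ , x≢1+m) → 1≤x , ≤-pred (≤∧≢⇒< x≤1+m x≢1+m)) (inRange-split (suc m) x∈)

punchIn-inRange : ∀ {i m x} → InRange m x → InRangeExcept (suc m) i (punchIn i x)
punchIn-inRange {i} {m} {x} (1≤x , x≤m) with x <? i
... | yes x<i rewrite punchIn-< x<i = (1≤x , m≤n⇒m≤1+n x≤m) , <⇒≢ x<i
... | no  x≮i rewrite punchIn-≥ (≮⇒≥ x≮i) = (s≤s z≤n , s≤s x≤m) , >⇒≢ (s≤s (≮⇒≥ x≮i))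

punchOut-inRange : ∀ {i m x} → 1 ≤ i → i ≤ suc m → InRangeExcept (suc m) i x → InRange m (punchOut i x)
punchOut-inRange {i} {m} {x} 1≤i i≤1+m ((1≤x , x≤1+m) , x≢i) with x <? i
... | yes x<i rewrite punchOut-< x<i = 1≤x , ≤-pred (≤-trans x<i i≤1+m)
... | no  x≮i with x | ≤∧≢⇒< (≮⇒≥ x≮i) (x≢i ∘ sym) | punchOut-≥ {i} {x} (≮⇒≥ x≮i)
...   | suc x′ | s≤s i≤x′ | eq rewrite eq = ≤-trans 1≤i i≤x′ , ≤-pred x≤1+m

mapC : (ℕ → ℕ) → Cycles → Cycles
mapC g = map (map g)

concat-mapC : ∀ g C → concat (mapC g C) ≡ map g (concat C)
concat-mapC g []      = refl
concat-mapC g (c ∷ C) = trans (cong (map g c ++_) (concat-mapC g C)) (sym (map-++ g c (concat C)))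

map-tail : ∀ (g : ℕ → ℕ) t Cs → map g t ++ concat (mapC g Cs) ≡ map g (t ++ concat Cs)
map-tail g t Cs = trans (cong (map g t ++_) (concat-mapC g Cs)) (sym (map-++ g t (concat Cs)))

length-mapC : ∀ g C → length (mapC g C) ≡ length C
length-mapC g = length-map (map g)

mapC-inverse : ∀ g h C → (∀ {x} → x ∈ concat C → g (h x) ≡ x) → mapC g (mapC h C) ≡ C
mapC-inverse g h []      _    = refl
mapC-inverse g h (c ∷ C) g∘h≗id = cong₂ _∷_ (map-inverse c (g∘h≗id ∘ ∈-++⁺ˡ)) (mapC-inverse g h C (g∘h≗id ∘ ∈-++⁺ʳ c))
  where
  map-inverse : ∀ c → (∀ {x} → x ∈ c → g (h x) ≡ x) → map g (map h c) ≡ c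
  map-inverse []      _    = refl
  map-inverse (x ∷ c) g∘h≗id = cong₂ _∷_ (g∘h≗id (here refl)) (map-inverse c (g∘h≗id ∘ there))

Ordered-map : ∀ g C → Ordered C → (∀ {x y} → x ∈ concat C → y ∈ concat C → x < y → g x < g y) → Ordered (mapC g C)
Ordered-map g []            _                  _    = tt
Ordered-map g ((h ∷ t) ∷ C) (h<t , h<C , ord) mono =
  map-< t h<t (λ y∈ → mono (here refl) (there (∈-++⁺ˡ y∈))) ,
  subst (All (g h <_)) (sym (concat-mapC g C)) (map-< (concat C) h<C (λ y∈ → mono (here refl) (∈-++⁺ʳ (h ∷ t) y∈))) ,
  Ordered-map g C ord (λ x∈ y∈ → mono (∈-++⁺ʳ (h ∷ t) x∈) (∈-++⁺ʳ (h ∷ t) y∈))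
  where
  map-< : ∀ ys → All (h <_) ys → (∀ {y} → y ∈ ys → h < y → g h < g y) → All (g h <_) (map g ys)
  map-< []       []           _    = []
  map-< (y ∷ ys) (h<y ∷ h<ys) mono = mono (here refl) h<y ∷ map-< ys h<ys (mono ∘ there)

Standard-map : ∀ {P Q : ℕ → Set} g {C} → Standard P C → StrictlyMonotoneOn P g →
  (∀ {x} → P x → Q (g x)) → (∀ {y} → Q y → ∃ λ x → P x × g x ≡ y) → Standard Q (mapC g C)
Standard-map {P} {Q} g {C} std mono P⇒Q Q⇒P = record
  { ordered  = Ordered-map g C (ordered std) (λ x∈ y∈ → mono (sound std x∈) (sound std y∈))
  ; unique   = subst Unique (sym (concat-mapC g C)) (Unique-map⁺ g (unique std) injective)
  ; sound    = λ y∈ → let (x , x∈ , y≡) = ∈-map⁻ g (subst (_ ∈_) (concat-mapC g C) y∈) in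
                      subst Q (sym y≡) (P⇒Q (sound std x∈))
  ; complete = λ qy → let (x , px , gx≡y) = Q⇒P qy in
                      subst (_∈ concat (mapC g C)) gx≡y (subst (_ ∈_) (sym (concat-mapC g C)) (∈-map⁺ g (complete std px)))
  }
  where
  injective : ∀ {x y} → x ∈ concat C → y ∈ concat C → g x ≡ g y → x ≡ y
  injective {x} {y} x∈ y∈ gx≡gy with <-cmp x y
  ... | tri< x<y _ _ = contradiction gx≡gy (<⇒≢ (mono (sound std x∈) (sound std y∈) x<y))
  ... | tri≈ _ x≡y _ = x≡y
  ... | tri> _ _ y<x = contradiction (sym gx≡gy) (<⇒≢ (mono (sound std y∈) (sound std x∈) y<x))

Standard-punchIn : ∀ {m i C} → 1 ≤ i → i ≤ suc m → Standard (InRange m) C →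
  Standard (InRangeExcept (suc m) i) (mapC (punchIn i) C)
Standard-punchIn {m} {i} 1≤i i≤1+m std = Standard-map (punchIn i) std (λ _ _ → punchIn-mono i) punchIn-inRange
  (λ y∈ → punchOut i _ , punchOut-inRange 1≤i i≤1+m y∈ , punchIn-punchOut (proj₂ y∈))

Standard-punchOut : ∀ {m i C} → 1 ≤ i → i ≤ suc m → Standard (InRangeExcept (suc m) i) C →
  Standard (InRange m) (mapC (punchOut i) C)
Standard-punchOut {m} {i} 1≤i i≤1+m std = Standard-map (punchOut i) std (λ x∈ y∈ → punchOut-mono i (proj₂ x∈) (proj₂ y∈))
  (punchOut-inRange 1≤i i≤1+m) (λ y∈ → punchIn i _ , punchIn-inRange y∈ , punchOut-punchIn {i})

contains12-3-punchIn : ∀ i w → contains12-3 (map (punchIn i) w) ≡ contains12-3 w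
contains12-3-punchIn i w =
  contains12-3-map (punchIn i) w (λ _ _ → strictlyMonotone⇒<ᵇ {P = λ _ → ⊤} (λ _ _ → punchIn-mono i) tt tt)

avoids-punchOut : ∀ i C → (∀ {x} → x ∈ concat C → x ≢ i) →
  contains12-3 (concat (mapC (punchOut i) C)) ≡ contains12-3 (concat C)
avoids-punchOut i C ≢i = trans (cong contains12-3 (concat-mapC (punchOut i) C))
  (contains12-3-map (punchOut i) (concat C) (strictlyMonotone⇒<ᵇ (λ x∈ y∈ → punchOut-mono i (≢i x∈) (≢i y∈))))

middle-↭ : ∀ (h : ℕ) t₁ L t₂ R → (h ∷ (t₁ ++ L ++ t₂) ++ R) ↭ L ++ (h ∷ (t₁ ++ t₂) ++ R)
middle-↭ h t₁ L t₂ R = ↭-trans (prep h (++⁺ʳ R (shifts t₁ L)))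
  (subst (λ z → h ∷ z ↭ L ++ h ∷ (t₁ ++ t₂) ++ R) (sym (++-assoc L (t₁ ++ t₂) R)) (↭-sym (shift h L ((t₁ ++ t₂) ++ R))))

Standard-delete : ∀ {P : ℕ → Set} h t₁ L t₂ {Cs} → Standard P ((h ∷ t₁ ++ L ++ t₂) ∷ Cs) →
  Standard (λ x → P x × x ∉ L) ((h ∷ t₁ ++ t₂) ∷ Cs)
Standard-delete h t₁ L t₂ {Cs} std = record
  { ordered  = All.tabulate (All.lookup h<t ∘ keep) , proj₂ (ordered std)
  ; unique   = uRest
  ; sound    = λ x∈ → sound std (∈-resp-↭ (↭-sym perm) (∈-++⁺ʳ L x∈)) , λ x∈L → disjoint x∈L x∈
  ; complete = λ (px , x∉L) → [ flip contradiction x∉L , id ]′ (∈-++⁻ L (∈-resp-↭ perm (complete std px)))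
  }
  where
  h<t = proj₁ (ordered std)
  perm = middle-↭ h t₁ L t₂ (concat Cs)
  uRest = proj₁ (proj₂ (Unique-++⁻ L (Unique-resp-↭ perm (unique std))))
  disjoint = proj₂ (proj₂ (Unique-++⁻ L (Unique-resp-↭ perm (unique std))))
  keep : ∀ {y} → y ∈ t₁ ++ t₂ → y ∈ t₁ ++ L ++ t₂
  keep y∈ = [ ∈-++⁺ˡ , ∈-++⁺ʳ t₁ ∘ ∈-++⁺ʳ L ]′ (∈-++⁻ t₁ y∈)

Standard-insert : ∀ {P : ℕ → Set} h t₁ L t₂ {Cs} → Standard P ((h ∷ t₁ ++ t₂) ∷ Cs) → All (h <_) L → Unique L →
  (∀ {x} → x ∈ L → ¬ P x) → Standard (λ x → x ∈ L ⊎ P x) ((h ∷ t₁ ++ L ++ t₂) ∷ Cs)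
Standard-insert h t₁ L t₂ {Cs} std h<L uL L∉P = record
  { ordered  = All.tabulate (λ y∈ → [ All.lookup h<L , All.lookup h<t ]′ (split y∈)) , proj₂ (ordered std)
  ; unique   = Unique-resp-↭ (↭-sym perm) (Unique.++⁺ uL (unique std) λ (x∈L , x∈) → L∉P x∈L (sound std x∈))
  ; sound    = λ x∈ → Sum.map₂ (sound std) (∈-++⁻ L (∈-resp-↭ perm x∈))
  ; complete = λ x∈ → ∈-resp-↭ (↭-sym perm) ([ ∈-++⁺ˡ , ∈-++⁺ʳ L ∘ complete std ]′ x∈)
  }
  where
  h<t = proj₁ (ordered std)
  perm = middle-↭ h t₁ L t₂ (concat Cs)
  split : ∀ {y} → y ∈ t₁ ++ L ++ t₂ → y ∈ L ⊎ y ∈ t₁ ++ t₂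
  split y∈ with ∈-++⁻ t₁ y∈
  ... | inj₁ y∈t₁ = inj₂ (∈-++⁺ˡ y∈t₁)
  ... | inj₂ y∈′ = Sum.map₂ (∈-++⁺ʳ t₁) (∈-++⁻ L y∈′)

-- Derangements are the forms without singleton cycles

long : List ℕ → Bool
long (_ ∷ _ ∷ _) = true
long _           = false

allLong : Cycles → Bool
allLong = all long

allLong-mapC : ∀ g C → allLong (mapC g C) ≡ allLong C
allLong-mapC g []                  = refl
allLong-mapC g ([] ∷ C)            = cong (false ∧_) (allLong-mapC g C)
allLong-mapC g ((_ ∷ []) ∷ C)      = refl
allLong-mapC g ((_ ∷ _ ∷ _) ∷ C)   = allLong-mapC g C

edgesFrom-irreflexive : ∀ h x t → Unique (x ∷ t) → h ∉ x ∷ t → ∀ {e} → e ∈ edgesFrom h x t → proj₁ e ≢ proj₂ e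
edgesFrom-irreflexive h x []      _              h∉ (here refl) x≡h = h∉ (here (sym x≡h))
edgesFrom-irreflexive h x (y ∷ t) (x∉ ∷ _)       _  (here refl)     = All.lookup x∉ (here refl)
edgesFrom-irreflexive h x (y ∷ t) (_ ∷ u)        h∉ (there e∈)      = edgesFrom-irreflexive h y t u (h∉ ∘ there) e∈

allLong⇒fixedPointFree : ∀ {f P} C → CycleFormOf f P C → T (allLong C) → ∀ {x} → x ∈ concat C → f x ≢ x
allLong⇒fixedPointFree {f} C F allLongC x∈ with c , x∈c , c∈C ← ∈-concat⁻′ C x∈ =
  in-cycle c x∈c (All.lookup (all⁺ long C allLongC) c∈C) (All.lookup (cycles F) c∈C) (unique-cycle C (unique (standard F)) c∈C)
  where
  unique-cycle : ∀ D {c} → Unique (concat D) → c ∈ D → Unique c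
  unique-cycle (d ∷ D) u (here refl) = proj₁ (Unique-++⁻ d u)
  unique-cycle (d ∷ D) u (there c∈)  = unique-cycle D (proj₁ (proj₂ (Unique-++⁻ d u))) c∈
  in-cycle : ∀ c {x} → x ∈ c → T (long c) → IsCycleOf f c → Unique c → f x ≢ x
  in-cycle (h ∷ y ∷ t) {x} x∈c _ cyc (h∉ ∷ u′) fx≡x
    with (x , z) , e∈ , refl ← ∈-map⁻ proj₁ (subst (x ∈_) (sym (sources-edgesFrom h h (y ∷ t))) x∈c) =
    irreflexive e∈ (trans (sym fx≡x) (All.lookup cyc e∈))
    where
    irreflexive : ∀ {e} → e ∈ edgesFrom h h (y ∷ t) → proj₁ e ≢ proj₂ e
    irreflexive (here refl) = All.lookup h∉ (here refl)
    irreflexive (there e∈)  = edgesFrom-irreflexive h y t u′ (λ h∈ → All.lookup h∉ h∈ refl) e∈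

fixedPointFree⇒allLong : ∀ {f} C → Ordered C → All (IsCycleOf f) C → (∀ {x} → x ∈ concat C → f x ≢ x) → T (allLong C)
fixedPointFree⇒allLong []                  _             _                  _     = tt
fixedPointFree⇒allLong ((x ∷ []) ∷ C)      _             ((fx≡x ∷ []) ∷ _) noFix = noFix (here refl) fx≡x
fixedPointFree⇒allLong ((x ∷ y ∷ t) ∷ C)   (_ , _ , ord) (_ ∷ cyc)         noFix =
  fixedPointFree⇒allLong C ord cyc (noFix ∘ ∈-++⁺ʳ (x ∷ y ∷ t))

isDerangement≡allLong : ∀ {m π} → π ∈ S m → isDerangement π ≡ allLong (cycleForm π)
isDerangement≡allLong {m} {π} π∈S = T-⇔⇒≡
  (λ der → fixedPointFree⇒allLong C (ordered (standard F)) (cycles F) λ x∈ →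
     not-≡ᵇ (All.lookup (all⁺ _ (oneTo (length π)) der)
                        (∈-oneTo⁺ (length π) (∈S⇒inRange-length {m} π∈S (sound (standard F) x∈)))))
  (λ allLongC → all⁻ _ (All.tabulate λ x∈ →
     ≢⇒not-≡ᵇ (allLong⇒fixedPointFree C F allLongC
                 (complete (standard F) (subst (λ k → InRange k _) (∈S⇒length {m} π∈S) (∈-oneTo⁻ (length π) x∈))))))
  where
  C = cycleForm π
  F = cycleForm-correct π∈S
  not-≡ᵇ : ∀ {a b} → T (not (a ≡ᵇ b)) → a ≢ b
  not-≡ᵇ {a} {b} a≢ᵇb a≡b = subst T (to T-not-≡ a≢ᵇb) (≡⇒≡ᵇ a b a≡b)
  ≢⇒not-≡ᵇ : ∀ {a b} → a ≢ b → T (not (a ≡ᵇ b))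
  ≢⇒not-≡ᵇ a≢b = from T-not-≡ (≢⇒≡ᵇ-false a≢b)

-- Counting permutations through their cycle forms

countForms : ℕ → (Cycles → Bool) → ℕ
countForms m P = length (filterᵇ (P ∘ cycleForm) (S m))

InvertibleOn : ℕ → (Cycles → Bool) → ℕ → (Cycles → Bool) → (Cycles → Cycles) → (Cycles → Cycles) → Set
InvertibleOn m P m′ Q op inv =
  ∀ {C} → Standard (InRange m) C → T (P C) → Standard (InRange m′) (op C) × T (Q (op C)) × inv (op C) ≡ C

countForms-bij : ∀ {m m′ P Q op inv} → InvertibleOn m P m′ Q op inv → InvertibleOn m′ Q m P inv op →
  countForms m P ≡ countForms m′ Q
countForms-bij {m} {m′} {P} {Q} {op} {inv} forth back =
  length-filterᵇ-bij _ _ (transport m′ op) (transport m inv) (S-unique m) (S-unique m′)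
    (lift {P = P} {Q} {op} {inv} forth) (lift {P = Q} {P} {inv} {op} back)
  where
  transport : ℕ → (Cycles → Cycles) → List ℕ → List ℕ
  transport k g π = fromCycles k (g (cycleForm π))
  lift : ∀ {k k′ P Q g h} → InvertibleOn k P k′ Q g h → ∀ {π} → π ∈ S k → T (P (cycleForm π)) →
    transport k′ g π ∈ S k′ × T (Q (cycleForm (transport k′ g π))) × transport k h (transport k′ g π) ≡ π
  lift {k} {k′} {Q = Q} {g} {h} inverts {π} π∈S pπ =
    let (std′ , q , h∘g) = inverts (standard (cycleForm-correct π∈S)) pπ
        round = FromCycles.cycleForm-fromCycles std′
    in FromCycles.fromCycles-∈S std′ , subst (T ∘ Q) (sym round) q ,
       trans (cong (fromCycles k ∘ h) round) (trans (cong (fromCycles k) h∘g) (fromCycles-cycleForm π∈S))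

countForms-cong : ∀ {m} P Q → (∀ {C} → Standard (InRange m) C → P C ≡ Q C) → countForms m P ≡ countForms m Q
countForms-cong {m} P Q P≗Q = cong length (filterᵇ-cong _ _ (S m) λ π∈S → P≗Q (standard (cycleForm-correct π∈S)))

countForms-split : ∀ m P R → countForms m P ≡ countForms m (λ C → P C ∧ R C) + countForms m (λ C → P C ∧ not (R C))
countForms-split m P R = length-filterᵇ-split (P ∘ cycleForm) (R ∘ cycleForm) (S m)

countForms-none : ∀ {m} P → (∀ {C} → Standard (InRange m) C → ¬ T (P C)) → countForms m P ≡ 0
countForms-none {m} P none = length-filterᵇ-none _ (S m) λ π∈S → none (standard (cycleForm-correct π∈S))

isD : Cycles → Bool
isD C = allLong C ∧ not (contains12-3 (concat C))

-- the cycle forms counted by w n and wi n i, with k cycles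
inD : ℕ → Cycles → Bool
inD k C = isD C ∧ (length C ≡ᵇ k)

inDᵢ : ℕ → ℕ → ℕ → Cycles → Bool
inDᵢ n i k C = (isD C ∧ startsWith1ni n i (concat C)) ∧ (length C ≡ᵇ k)

w≡countForms : ∀ n k → w n k ≡ countForms n (inD k)
w≡countForms n k = trans (cong length (filterᵇ-filterᵇ _ _ (S n)))
  (cong length (filterᵇ-cong _ _ (S n) λ {π} π∈S →
     cong (λ b → (b ∧ not (contains12-3 (flat π))) ∧ (μ π ≡ᵇ k)) (isDerangement≡allLong {n} π∈S)))

wi≡countForms : ∀ n i k → wi n i k ≡ countForms n (inDᵢ n i k)
wi≡countForms n i k = trans (cong (length ∘ filterᵇ _) (filterᵇ-filterᵇ _ _ (S n)))
  (trans (cong length (filterᵇ-filterᵇ _ _ (S n)))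
    (cong length (filterᵇ-cong _ _ (S n) λ {π} π∈S →
       cong (λ b → ((b ∧ not (contains12-3 (flat π))) ∧ startsWith1ni n i (flat π)) ∧ (μ π ≡ᵇ k))
         (isDerangement≡allLong {n} π∈S))))

isD⁻ : ∀ C → T (isD C) → T (allLong C) × Avoids (concat C)
isD⁻ C isDC = let (allLongC , avoidsC) = to T-∧ isDC in allLongC , to T-not-≡ avoidsC

isD⁺ : ∀ C → T (allLong C) → Avoids (concat C) → T (isD C)
isD⁺ C allLongC avoidsC = from T-∧ (allLongC , from T-not-≡ avoidsC)

inD⁻ : ∀ {k} C → T (inD k C) → T (isD C) × length C ≡ k
inD⁻ {k} C p = let (isDC , len) = to T-∧ p in isDC , ≡ᵇ⇒≡ (length C) k len

inD⁺ : ∀ {k} C → T (isD C) → length C ≡ k → T (inD k C)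
inD⁺ C isDC len = from T-∧ (isDC , ≡⇒≡ᵇ _ _ len)

inDᵢ⁻ : ∀ {n i k} C → T (inDᵢ n i k C) → T (isD C) × T (startsWith1ni n i (concat C)) × length C ≡ k
inDᵢ⁻ {k = k} C p = let (q , len) = to T-∧ p ; (isDC , starts) = to T-∧ q in
  isDC , starts , ≡ᵇ⇒≡ (length C) k len

inDᵢ⁺ : ∀ {n i k} C → T (isD C) → T (startsWith1ni n i (concat C)) → length C ≡ k → T (inDᵢ n i k C)
inDᵢ⁺ C isDC starts len = from T-∧ (from T-∧ (isDC , starts) , ≡⇒≡ᵇ _ _ len)

-- The first letters of a 12-3-avoiding derangement form

-- junk value 0 for words with fewer than three letters
third : List ℕ → ℕ
third (_ ∷ _ ∷ x ∷ _) = x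
third _               = 0

startsWith⇒third : ∀ {n i} w → T (startsWith1ni n i w) → third w ≡ i
startsWith⇒third {n} {i} (a ∷ b ∷ c ∷ _) starts = ≡ᵇ⇒≡ c i (proj₂ (to T-∧ (proj₂ (to (T-∧ {a ≡ᵇ 1}) starts))))

startsWith1ni⁺ : ∀ n i rest → T (startsWith1ni n i (1 ∷ n ∷ i ∷ rest))
startsWith1ni⁺ n i rest = from T-∧ (tt , from T-∧ (≡ᵇ-refl n , ≡ᵇ-refl i))

head≡1 : ∀ {m C} → Standard (InRange m) C → 1 ≤ m → ∃ λ t → ∃ λ Cs → C ≡ (1 ∷ t) ∷ Cs
head≡1 {C = []}            std 1≤m with () ← complete std (≤-refl , 1≤m)
head≡1 {C = [] ∷ _}        std _   = ⊥-elim (ordered std)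
head≡1 {C = (h ∷ t) ∷ Cs}  std 1≤m
  with refl ← ≤-antisym (Ordered-head≤ (ordered std) (complete std (≤-refl , 1≤m))) (proj₁ (sound std (here refl))) =
  t , Cs , refl

-- 1 < x is an ascent, so nothing after x exceeds it: x is the largest letter m
firstCycle≡1m : ∀ {m C} → Standard (InRange m) C → 2 ≤ m → T (isD C) → ∃ λ t → ∃ λ Cs → C ≡ (1 ∷ m ∷ t) ∷ Cs
firstCycle≡1m {m} std 2≤m isDC with head≡1 std (≤-trans (s≤s z≤n) 2≤m)
... | [] , Cs , refl = ⊥-elim (proj₁ (isD⁻ ((1 ∷ []) ∷ Cs) isDC))
... | x ∷ t , Cs , refl = t , Cs , cong (λ z → (1 ∷ z ∷ t) ∷ Cs) (≤-antisym x≤m m≤x)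
  where
  x≤m = proj₂ (sound std (there (here refl)))
  1<x : 1 < x
  1<x = ≤∧≢⇒< (proj₁ (sound std (there (here refl)))) λ { refl → Unique[x∷xs]⇒x∉xs (unique std) (here refl) }
  m≤x : m ≤ x
  m≤x with complete std (≤-trans (s≤s z≤n) 2≤m , ≤-refl)
  ... | here m≡1         = contradiction (sym m≡1) (<⇒≢ 2≤m)
  ... | there (here m≡x) = ≤-reflexive m≡x
  ... | there (there m∈) = All.lookup (avoids-ascent (t ++ concat Cs) 1<x (proj₂ (isD⁻ ((1 ∷ x ∷ t) ∷ Cs) isDC))) m∈

nextHead≤ : ∀ {P : ℕ → Set} {c Cs x} → Standard P (c ∷ Cs) → x ∈ concat Cs →
  ∃ λ h → ∃ λ t → ∃ λ Cs′ → Cs ≡ (h ∷ t) ∷ Cs′ × h ≤ x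
nextHead≤ {c = []}    std _ = ⊥-elim (ordered std)
nextHead≤ {c = _ ∷ _} {[] ∷ _}        std _  = ⊥-elim (proj₂ (proj₂ (ordered std)))
nextHead≤ {c = _ ∷ _} {(h ∷ t) ∷ Cs′} std x∈ = h , t , Cs′ , refl , Ordered-head≤ (proj₂ (proj₂ (ordered std))) x∈

fourthAbove : ℕ → Cycles → Bool
fourthAbove i ((_ ∷ _ ∷ _ ∷ y ∷ _) ∷ _) = i <ᵇ y
fourthAbove i _                         = false

dropThird : Cycles → Cycles
dropThird ((h ∷ y ∷ _ ∷ t) ∷ Cs) = (h ∷ y ∷ t) ∷ Cs
dropThird C                      = C

insertThird : ℕ → Cycles → Cycles
insertThird i ((h ∷ y ∷ t) ∷ Cs) = (h ∷ y ∷ i ∷ t) ∷ Cs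
insertThird i C                  = C

third-exists : ∀ {n t Cs} → Standard (InRange n) ((1 ∷ n ∷ t) ∷ Cs) → 3 ≤ n →
  ∃ λ j → ∃ λ r → t ++ concat Cs ≡ j ∷ r × 2 ≤ j × j < n
third-exists {n} {t} {Cs} std 3≤n with unique std
... | 1∉ ∷ n∉ ∷ _ with t ++ concat Cs in eq
... | [] with () ← subst (2 ∈_) eq (∈-tail² (complete std (s≤s z≤n , ≤-trans (s≤s (s≤s z≤n)) 3≤n)) (λ ()) (<⇒≢ 3≤n))
... | j ∷ r = j , r , refl ,
  ≤∧≢⇒< (proj₁ j∈) (All.lookup 1∉ (there (here refl))) ,
  ≤∧≢⇒< (proj₂ j∈) (All.head n∉ ∘ sym)
  where
  j∈ : InRange n j
  j∈ = sound std (there (there (subst (j ∈_) (sym eq) (here refl))))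

-- the letter after a first cycle (1 n) heads the next cycle, so it is at most 2
third-after-short-cycle : ∀ {n Cs} → Standard (InRange n) ((1 ∷ n ∷ []) ∷ Cs) → 3 ≤ n →
  third (concat ((1 ∷ n ∷ []) ∷ Cs)) ≤ 2
third-after-short-cycle {n} std 3≤n
  with h , t , Cs′ , refl , h≤2 ← nextHead≤ std (∈-tail² (complete std (s≤s z≤n , ≤-trans (n≤1+n 2) 3≤n)) (λ ()) (<⇒≢ 3≤n))
  = h≤2

-- Three bijections between forms

-- (1 n i j …) with j < i  ↔  (1 n−1 j …): delete the third letter i and close the gap
module DeleteThird {m i : ℕ} (3≤i : 3 ≤ i) (i≤m : i ≤ m) (k : ℕ) where

  private
    n = suc m
    1<i : 1 < i
    1<i = ≤-trans (s≤s (s≤s z≤n)) 3≤i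
    i≤n : i ≤ n
    i≤n = m≤n⇒m≤1+n i≤m
    3≤m : 3 ≤ m
    3≤m = ≤-trans 3≤i i≤m
    2≤n : 2 ≤ n
    2≤n = s≤s (≤-trans (s≤s z≤n) 3≤m)
    3≤n : 3 ≤ n
    3≤n = m≤n⇒m≤1+n 3≤m

  P Q : Cycles → Bool
  P C = inDᵢ n i k C ∧ not (fourthAbove i C)
  Q C = inD k C ∧ (third (concat C) <ᵇ i)

  forth back : Cycles → Cycles
  forth = mapC (punchOut i) ∘ dropThird
  back  = insertThird i ∘ mapC (punchIn i)

  two∈later : ∀ {Cs} → Standard (InRange n) ((1 ∷ n ∷ i ∷ []) ∷ Cs) → 2 ∈ concat Cs
  two∈later std with ∈-tail² (complete std (s≤s z≤n , ≤-trans (s≤s (s≤s z≤n)) 3≤n)) (λ ()) (<⇒≢ 3≤n)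
  ... | here 2≡i = contradiction 2≡i (<⇒≢ 3≤i)
  ... | there 2∈ = 2∈

  letterAfterThird : ∀ {t Cs} → Standard (InRange n) ((1 ∷ n ∷ i ∷ t) ∷ Cs) → T (not (fourthAbove i ((1 ∷ n ∷ i ∷ t) ∷ Cs))) →
    ∃ λ j → ∃ λ r → t ++ concat Cs ≡ j ∷ r × j < i
  letterAfterThird {y ∷ t} std ¬above with unique std
  ... | _ ∷ _ ∷ (i≢y ∷ _) ∷ _ =
    y , _ , refl , ≤∧≢⇒< (≮⇒≥ λ i<y → subst T (to T-not-≡ ¬above) (<⇒<ᵇ i<y)) (i≢y ∘ sym)
  letterAfterThird {[]} {Cs} std _ with h , t′ , Cs′ , refl , h≤2 ← nextHead≤ std (two∈later std) =
    h , t′ ++ concat Cs′ , refl , ≤-<-trans h≤2 3≤i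

  forth-standard : ∀ {t Cs} → Standard (InRange n) ((1 ∷ n ∷ i ∷ t) ∷ Cs) → Standard (InRangeExcept n i) ((1 ∷ n ∷ t) ∷ Cs)
  forth-standard {t} std = Standard-⇔ (λ (x∈ , x∉) → x∈ , x∉ ∘ here) (λ (x∈ , x≢i) → x∈ , λ { (here x≡i) → x≢i x≡i })
    (Standard-delete 1 (n ∷ []) (i ∷ []) t std)

  back-standard : ∀ {t Cs} → Standard (InRange m) ((1 ∷ m ∷ t) ∷ Cs) → Standard (InRange n) (back ((1 ∷ m ∷ t) ∷ Cs))
  back-standard {t} std = Standard-⇔ [ (λ { (here refl) → <⇒≤ 1<i , i≤n }) , proj₁ ]′ (Sum.map₁ here ∘ inRange-split i)
    (Standard-insert (punchIn i 1) (punchIn i m ∷ []) (i ∷ []) (map (punchIn i) t) (Standard-punchIn (<⇒≤ 1<i) i≤n std)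
      (subst (_< i) (sym (punchIn-< 1<i)) 1<i ∷ []) ([] ∷ []) λ { (here refl) (_ , i≢i) → i≢i refl })

  fourth-not-above : ∀ t {Cs j r} → t ++ concat Cs ≡ j ∷ r → j < i → T (not (fourthAbove i (back ((1 ∷ m ∷ t) ∷ Cs))))
  fourth-not-above []      _    _   = tt
  fourth-not-above (y ∷ _) refl y<i = from T-not-≡ (≥⇒<ᵇ-false (≤-trans (≤-reflexive (punchIn-< y<i)) (<⇒≤ y<i)))

  forth-ok : InvertibleOn n P m Q forth back
  forth-ok {C} std PC with to T-∧ PC
  ... | inDᵢC , ¬above with inDᵢ⁻ C inDᵢC
  ... | isDC , starts , len with firstCycle≡1m std 2≤n isDC
  ... | [] , Cs , refl =
    contradiction (subst (_≤ 2) (startsWith⇒third {n} {i} (concat C) starts) (third-after-short-cycle std 3≤n)) (<⇒≱ 3≤i)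
  ... | a ∷ t , Cs , refl with refl ← startsWith⇒third {n} {i} (concat C) starts
                          with j , r , rest≡ , j<i ← letterAfterThird std ¬above =
    std′ , from T-∧ (inD⁺ (forth C) (isD⁺ (forth C) allLong′ avoids′) (trans (length-mapC _ D) len) , <⇒<ᵇ third<i) ,
    cong (insertThird i) (mapC-inverse (punchIn i) (punchOut i) D (punchIn-punchOut ∘ ≢i))
    where
    D = (1 ∷ n ∷ t) ∷ Cs
    stdD : Standard (InRangeExcept n i) D
    stdD = forth-standard std
    std′ : Standard (InRange m) (forth C)
    std′ = Standard-punchOut (<⇒≤ 1<i) i≤n stdD
    ≢i : ∀ {x} → x ∈ concat D → x ≢ i
    ≢i = proj₂ ∘ sound stdD
    ≤n : All (_≤ n) (i ∷ j ∷ r)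
    ≤n = All.tail (All.tail (subst (λ w → All (_≤ n) (1 ∷ n ∷ i ∷ w)) rest≡ (letters≤ std)))
    allLong′ : T (allLong (forth C))
    allLong′ = subst T (sym (allLong-mapC (punchOut i) D)) (proj₁ (isD⁻ C isDC))
    avoids′ : Avoids (concat (forth C))
    avoids′ = begin
      contains12-3 (concat (mapC (punchOut i) D)) ≡⟨ avoids-punchOut i D ≢i ⟩
      contains12-3 (1 ∷ n ∷ t ++ concat Cs)      ≡⟨ cong (λ w → contains12-3 (1 ∷ n ∷ w)) rest≡ ⟩
      contains12-3 (1 ∷ n ∷ j ∷ r)               ≡⟨ contains12-3-drop-middle 1 r ≤n (s≤s i≤m) j<i ⟨
      contains12-3 (1 ∷ n ∷ i ∷ j ∷ r)           ≡⟨ cong (λ w → contains12-3 (1 ∷ n ∷ i ∷ w)) rest≡ ⟨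
      contains12-3 (concat C)                    ≡⟨ proj₂ (isD⁻ C isDC) ⟩
      false                                      ∎
      where open ≡-Reasoning
    third<i : third (concat (forth C)) < i
    third<i = subst (_< i) (trans (sym (punchOut-< j<i)) (cong third (sym concat≡))) j<i
      where concat≡ = trans (concat-mapC (punchOut i) D) (cong (λ w → map (punchOut i) (1 ∷ n ∷ w)) rest≡)

  back-ok : InvertibleOn m Q n P back forth
  back-ok {C} std QC with to T-∧ QC
  ... | inDC , third<ᵇi with inD⁻ C inDC
  ... | isDC , len with firstCycle≡1m std (≤-trans (s≤s (s≤s z≤n)) 3≤m) isDC
  ... | t , Cs , refl with j , r , rest≡ , _ , _ ← third-exists std 3≤m =
    std′ , from T-∧ (inDᵢ⁺ {n} {i} (back C) (isD⁺ (back C) allLong′ avoids′) starts′ (trans (length-mapC g C) len) ,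
                     fourth-not-above t rest≡ j<i) ,
    mapC-inverse (punchOut i) (punchIn i) C (λ _ → punchOut-punchIn {i})
    where
    g = punchIn i
    j<i : j < i
    j<i = <ᵇ⇒< j i (subst (λ w → T (third (1 ∷ m ∷ w) <ᵇ i)) rest≡ third<ᵇi)
    std′ : Standard (InRange n) (back C)
    std′ = back-standard std
    tail≡ : map g (t ++ concat Cs) ≡ j ∷ map g r
    tail≡ = trans (cong (map g) rest≡) (cong (_∷ map g r) (punchIn-< j<i))
    g1≡ = punchIn-< {i} {1} 1<i
    gm≡ = punchIn-≥ {i} {m} i≤m
    mapped≡ : map g (concat C) ≡ 1 ∷ n ∷ j ∷ map g r
    mapped≡ = trans (cong₂ (λ a b → a ∷ b ∷ map g (t ++ concat Cs)) g1≡ gm≡) (cong (λ w → 1 ∷ n ∷ w) tail≡)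
    concat≡ : concat (back C) ≡ 1 ∷ n ∷ i ∷ j ∷ map g r
    concat≡ = trans (cong₂ (λ a b → a ∷ b ∷ i ∷ map g t ++ concat (mapC g Cs)) g1≡ gm≡)
                    (cong (λ w → 1 ∷ n ∷ i ∷ w) (trans (map-tail g t Cs) tail≡))
    allLong′ : T (allLong (back C))
    allLong′ = subst T (sym (allLong-mapC g Cs)) (proj₁ (isD⁻ C isDC))
    avoids′ : Avoids (concat (back C))
    avoids′ = begin
      contains12-3 (concat (back C))           ≡⟨ cong contains12-3 concat≡ ⟩
      contains12-3 (1 ∷ n ∷ i ∷ j ∷ map g r)   ≡⟨ contains12-3-drop-middle 1 (map g r) ≤n (s≤s i≤m) j<i ⟩
      contains12-3 (1 ∷ n ∷ j ∷ map g r)       ≡⟨ cong contains12-3 mapped≡ ⟨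
      contains12-3 (map g (concat C))          ≡⟨ contains12-3-punchIn i (concat C) ⟩
      contains12-3 (concat C)                  ≡⟨ proj₂ (isD⁻ C isDC) ⟩
      false                                    ∎
      where
      open ≡-Reasoning
      ≤n = All.tail (All.tail (subst (All (_≤ n)) concat≡ (letters≤ std′)))
    starts′ : T (startsWith1ni n i (concat (back C)))
    starts′ = subst (T ∘ startsWith1ni n i) (sym concat≡) (startsWith1ni⁺ n i (j ∷ map g r))

  countForms-deleteThird : countForms (suc m) P ≡ countForms m Q
  countForms-deleteThird = countForms-bij forth-ok back-ok

dropSecondThird : Cycles → Cycles
dropSecondThird ((h ∷ _ ∷ _ ∷ t) ∷ Cs) = (h ∷ t) ∷ Cs
dropSecondThird C                      = C

insertAfterHead : List ℕ → Cycles → Cycles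
insertAfterHead L ((h ∷ t) ∷ Cs) = (h ∷ L ++ t) ∷ Cs
insertAfterHead L C              = C

-- (1 n i y …) with y > i  ↔  (1 y′ …): delete n and i and close the gap
module DeleteSecondThird {m i : ℕ} (2≤i : 2 ≤ i) (i≤m : i ≤ m) (k : ℕ) where

  private
    n = suc (suc m)
    1<i : 1 < i
    1<i = 2≤i
    1≤i : 1 ≤ i
    1≤i = <⇒≤ 1<i
    i≤1+m : i ≤ suc m
    i≤1+m = m≤n⇒m≤1+n i≤m
    2≤m : 2 ≤ m
    2≤m = ≤-trans 2≤i i≤m
    g1≡ : punchIn i 1 ≡ 1
    g1≡ = punchIn-< 1<i
    gm≡ : punchIn i m ≡ suc m
    gm≡ = punchIn-≥ i≤m

  P Q : Cycles → Bool
  P C = inDᵢ n i k C ∧ fourthAbove i C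
  Q   = inD k

  forth back : Cycles → Cycles
  forth = mapC (punchOut i) ∘ dropSecondThird
  back  = insertAfterHead (n ∷ i ∷ []) ∘ mapC (punchIn i)

  forth-standard : ∀ {y t Cs} → Standard (InRange n) ((1 ∷ n ∷ i ∷ y ∷ t) ∷ Cs) →
    Standard (InRangeExcept (suc m) i) ((1 ∷ y ∷ t) ∷ Cs)
  forth-standard {y} {t} std =
    Standard-⇔ (λ ((1≤x , x≤n) , x∉) → (1≤x , ≤-pred (≤∧≢⇒< x≤n (x∉ ∘ here))) , x∉ ∘ there ∘ here)
      (λ ((1≤x , x≤1+m) , x≢i) → (1≤x , m≤n⇒m≤1+n x≤1+m) ,
        λ { (here refl) → 1+n≰n x≤1+m ; (there (here x≡i)) → x≢i x≡i })
      (Standard-delete 1 [] (n ∷ i ∷ []) (y ∷ t) std)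

  back-standard : ∀ {t Cs} → Standard (InRange m) ((1 ∷ m ∷ t) ∷ Cs) → Standard (InRange n) (back ((1 ∷ m ∷ t) ∷ Cs))
  back-standard {t} std = Standard-⇔ into outof
    (Standard-insert (punchIn i 1) [] (n ∷ i ∷ []) (map (punchIn i) (m ∷ t)) (Standard-punchIn 1≤i i≤1+m std)
      (subst (_< n) (sym g1≡) (s≤s (s≤s z≤n)) ∷ subst (_< i) (sym g1≡) 1<i ∷ [])
      ((>⇒≢ (s≤s i≤1+m) ∷ []) ∷ [] ∷ [])
      λ { (here refl) ((_ , n≤1+m) , _) → 1+n≰n n≤1+m ; (there (here refl)) (_ , i≢i) → i≢i refl })
    where
    into : ∀ {x} → x ∈ n ∷ i ∷ [] ⊎ InRangeExcept (suc m) i x → InRange n x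
    into (inj₁ (here refl))         = s≤s z≤n , ≤-refl
    into (inj₁ (there (here refl))) = 1≤i , m≤n⇒m≤1+n i≤1+m
    into (inj₂ ((1≤x , x≤1+m) , _))  = 1≤x , m≤n⇒m≤1+n x≤1+m
    outof : ∀ {x} → InRange n x → x ∈ n ∷ i ∷ [] ⊎ InRangeExcept (suc m) i x
    outof x∈ with inRange-splitTop x∈
    ... | inj₁ x≡n = inj₁ (here x≡n)
    ... | inj₂ x∈′ = Sum.map₁ (there ∘ here) (inRange-split i x∈′)

  forth-ok : InvertibleOn n P m Q forth back
  forth-ok {C} std PC with to T-∧ PC
  ... | inDᵢC , above with inDᵢ⁻ C inDᵢC
  -- on shorter first cycles `above : T false` is empty, so those cases need no clause
  ... | isDC , starts , len with firstCycle≡1m std (s≤s (s≤s z≤n)) isDC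
  ... | a ∷ y ∷ t , Cs , refl with refl ← startsWith⇒third {n} {i} (concat C) starts =
    std′ , inD⁺ (forth C) (isD⁺ (forth C) allLong′ avoids′) (trans (length-mapC _ D) len) ,
    cong (insertAfterHead (n ∷ i ∷ [])) (mapC-inverse (punchIn i) (punchOut i) D (punchIn-punchOut ∘ ≢i))
    where
    D = (1 ∷ y ∷ t) ∷ Cs
    rest = t ++ concat Cs
    stdD : Standard (InRangeExcept (suc m) i) D
    stdD = forth-standard std
    std′ : Standard (InRange m) (forth C)
    std′ = Standard-punchOut 1≤i i≤1+m stdD
    ≢i : ∀ {x} → x ∈ concat D → x ≢ i
    ≢i = proj₂ ∘ sound stdD
    allLong′ : T (allLong (forth C))
    allLong′ = subst T (sym (allLong-mapC (punchOut i) D)) (proj₁ (isD⁻ C isDC))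
    avoids′ : Avoids (concat (forth C))
    avoids′ = begin
      contains12-3 (concat (mapC (punchOut i) D)) ≡⟨ avoids-punchOut i D ≢i ⟩
      contains12-3 (1 ∷ y ∷ rest)                 ≡⟨ contains12-3-skip-max 1 rest (avoids-ascent rest (<ᵇ⇒< i y above) avoids-iy) ⟩
      contains12-3 (y ∷ rest)                     ≡⟨ avoids-tail i (y ∷ rest) avoids-iy ⟩
      false                                       ∎
      where
      open ≡-Reasoning
      avoids-iy : Avoids (i ∷ y ∷ rest)
      avoids-iy = avoids-tail n (i ∷ y ∷ rest) (avoids-tail 1 (n ∷ i ∷ y ∷ rest) (proj₂ (isD⁻ C isDC)))

  concat-back : ∀ t Cs → concat (back ((1 ∷ m ∷ t) ∷ Cs)) ≡ 1 ∷ n ∷ i ∷ suc m ∷ map (punchIn i) (t ++ concat Cs)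
  concat-back t Cs =
    trans (cong₂ (λ a b → a ∷ n ∷ i ∷ b ∷ map (punchIn i) t ++ concat (mapC (punchIn i) Cs)) g1≡ gm≡)
          (cong (λ w → 1 ∷ n ∷ i ∷ suc m ∷ w) (map-tail (punchIn i) t Cs))

  back-avoids : ∀ {t Cs} → Standard (InRange m) ((1 ∷ m ∷ t) ∷ Cs) → Avoids (1 ∷ m ∷ t ++ concat Cs) →
    Avoids (concat (back ((1 ∷ m ∷ t) ∷ Cs)))
  back-avoids {t} {Cs} std avoids = begin
    contains12-3 (concat (back ((1 ∷ m ∷ t) ∷ Cs))) ≡⟨ cong contains12-3 (concat-back t Cs) ⟩
    contains12-3 (1 ∷ n ∷ i ∷ suc m ∷ W)    ≡⟨ contains12-3-skip-max 1 (i ∷ suc m ∷ W) (i≤n ∷ n≤1+n _ ∷ All.map m≤n⇒m≤1+n W≤) ⟩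
    contains12-3 (n ∷ i ∷ suc m ∷ W)        ≡⟨ contains12-3-skip-descent (suc m ∷ W) (s≤s i≤1+m) ⟩
    contains12-3 (i ∷ suc m ∷ W)            ≡⟨ contains12-3-skip-max i W W≤ ⟩
    contains12-3 (suc m ∷ W)                ≡⟨ contains12-3-skip-max 1 W W≤ ⟨
    contains12-3 (1 ∷ suc m ∷ W)            ≡⟨ cong contains12-3 mapped≡ ⟨
    contains12-3 (map g (1 ∷ m ∷ t ++ concat Cs)) ≡⟨ contains12-3-punchIn i (1 ∷ m ∷ t ++ concat Cs) ⟩
    contains12-3 (1 ∷ m ∷ t ++ concat Cs)   ≡⟨ avoids ⟩
    false                                   ∎
    where
    open ≡-Reasoning
    g = punchIn i
    W = map g (t ++ concat Cs)
    i≤n = m≤n⇒m≤1+n i≤1+m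
    mapped≡ : map g (1 ∷ m ∷ t ++ concat Cs) ≡ 1 ∷ suc m ∷ W
    mapped≡ = cong₂ (λ a b → a ∷ b ∷ W) g1≡ gm≡
    W≤ : All (_≤ suc m) W
    W≤ = All.tail (All.tail (subst (All (_≤ suc m)) mapped≡
      (map⁺ (All.tabulate λ x∈ → proj₂ (proj₁ (punchIn-inRange {i} (sound std x∈)))))))

  back-ok : InvertibleOn m Q n P back forth
  back-ok {C} std QC with inD⁻ C QC
  ... | isDC , len with firstCycle≡1m std 2≤m isDC
  ... | t , Cs , refl =
    back-standard std ,
    from T-∧ (inDᵢ⁺ {n} {i} (back C) (isD⁺ (back C) allLong′ (back-avoids std (proj₂ (isD⁻ C isDC)))) starts′
                     (trans (length-mapC (punchIn i) C) len) ,
              subst (λ x → T (i <ᵇ x)) (sym gm≡) (<⇒<ᵇ (s≤s i≤m))) ,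
    mapC-inverse (punchOut i) (punchIn i) C (λ _ → punchOut-punchIn {i})
    where
    allLong′ : T (allLong (back C))
    allLong′ = subst T (sym (allLong-mapC (punchIn i) Cs)) (proj₁ (isD⁻ C isDC))
    starts′ : T (startsWith1ni n i (concat (back C)))
    starts′ = subst (T ∘ startsWith1ni n i) (sym (concat-back t Cs)) (startsWith1ni⁺ n i (suc m ∷ map (punchIn i) (t ++ concat Cs)))

  countForms-deleteSecondThird : countForms (suc (suc m)) P ≡ countForms m Q
  countForms-deleteSecondThird = countForms-bij forth-ok back-ok

-- (1 n)(2 …) …  ↔  (1 …) …: delete the cycle (1 n) and close the gaps
module DeleteFirstCycle {m : ℕ} (3≤m : 3 ≤ m) (k : ℕ) where

  private
    n = suc (suc m)
    1≤1+m : 1 ≤ suc m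
    1≤1+m = s≤s z≤n

  P Q : Cycles → Bool
  P C = inDᵢ n 2 (suc k) C ∧ not (fourthAbove 2 C)
  Q   = inD k

  forth back : Cycles → Cycles
  forth C = mapC (punchOut 1) (drop 1 C)
  back C  = (1 ∷ n ∷ []) ∷ mapC (punchIn 1) C

  three∈ : ∀ {w} → 3 ∈ 1 ∷ n ∷ 2 ∷ w → 3 ∈ w
  three∈ (there (here 3≡n))         = contradiction 3≡n (<⇒≢ (s≤s (s≤s (≤-trans (s≤s (s≤s z≤n)) 3≤m))))
  three∈ (there (there (there 3∈))) = 3∈

  -- in (1 n 2)(h …) … the ascent 2 < h would force every later letter, m + 1 among them, below h ≤ 3
  no-short-first-cycle : ∀ {Cs} → Standard (InRange n) ((1 ∷ n ∷ 2 ∷ []) ∷ Cs) → ¬ Avoids (1 ∷ n ∷ 2 ∷ concat Cs)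
  no-short-first-cycle {Cs} std avoids
    with h , t , Cs′ , refl , h≤3 ← nextHead≤ std (three∈ (complete std (s≤s z≤n , ≤-trans 3≤m (≤-trans (n≤1+n _) (n≤1+n _)))))
    = <⇒≱ (s≤s 3≤m) (≤-trans 1+m≤h h≤3)
    where
    2<h : 2 < h
    2<h with unique std
    ... | 1∉ ∷ _ ∷ (2≢h ∷ _) ∷ _ =
      ≤∧≢⇒< (≤∧≢⇒< (proj₁ (sound std (there (there (there (here refl)))))) (All.lookup 1∉ (there (there (here refl))))) 2≢h
    1+m≤h : suc m ≤ h
    1+m≤h with complete std (s≤s z≤n , n≤1+n (suc m))
    ... | here 1+m≡1 = contradiction (suc-injective 1+m≡1) (>⇒≢ (≤-trans (s≤s z≤n) 3≤m))
    ... | there (here 1+m≡n) = contradiction (sym 1+m≡n) 1+n≢n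
    ... | there (there (here 1+m≡2)) = contradiction (suc-injective 1+m≡2) (>⇒≢ (≤-trans (s≤s (s≤s z≤n)) 3≤m))
    ... | there (there (there (here 1+m≡h))) = ≤-reflexive 1+m≡h
    ... | there (there (there (there 1+m∈))) = All.lookup (avoids-ascent (t ++ concat Cs′) 2<h avoids-2h) 1+m∈
      where avoids-2h = avoids-tail n (2 ∷ h ∷ t ++ concat Cs′) (avoids-tail 1 (n ∷ 2 ∷ h ∷ t ++ concat Cs′) avoids)

  forth-standard : ∀ {Cs} → Standard (InRange n) ((1 ∷ n ∷ []) ∷ Cs) → Standard (InRangeExcept (suc m) 1) Cs
  forth-standard std =
    Standard-⇔ (λ ((1≤x , x≤n) , x∉) → (1≤x , ≤-pred (≤∧≢⇒< x≤n (x∉ ∘ there ∘ here))) , x∉ ∘ here)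
      (λ ((1≤x , x≤1+m) , x≢1) → (1≤x , m≤n⇒m≤1+n x≤1+m) ,
        λ { (here x≡1) → x≢1 x≡1 ; (there (here refl)) → 1+n≰n x≤1+m ; (there (there ())) })
      (Standard-tail std)

  back-standard : ∀ {C} → Standard (InRange m) C → Standard (InRange n) (back C)
  back-standard std = Standard-⇔ into outof
    (Standard-∷ stdX (s≤s (s≤s z≤n) ∷ [])
      (All.tabulate λ x∈ → let ((1≤x , _) , x≢1) = sound stdX x∈ in ≤∧≢⇒< 1≤x (x≢1 ∘ sym))
      ((<⇒≢ (s≤s (s≤s z≤n)) ∷ []) ∷ [] ∷ [])
      λ { (here refl) (_ , 1≢1) → 1≢1 refl ; (there (here refl)) ((_ , n≤1+m) , _) → 1+n≰n n≤1+m })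
    where
    stdX = Standard-punchIn ≤-refl 1≤1+m std
    into : ∀ {x} → x ∈ 1 ∷ n ∷ [] ⊎ InRangeExcept (suc m) 1 x → InRange n x
    into (inj₁ (here refl))         = ≤-refl , s≤s z≤n
    into (inj₁ (there (here refl))) = s≤s z≤n , ≤-refl
    into (inj₂ ((1≤x , x≤1+m) , _))  = 1≤x , m≤n⇒m≤1+n x≤1+m
    outof : ∀ {x} → InRange n x → x ∈ 1 ∷ n ∷ [] ⊎ InRangeExcept (suc m) 1 x
    outof x∈ with inRange-splitTop x∈
    ... | inj₁ x≡n = inj₁ (there (here x≡n))
    ... | inj₂ x∈′ = Sum.map₁ here (inRange-split 1 x∈′)

  forth-ok : InvertibleOn n P m Q forth back
  forth-ok {C} std PC with to T-∧ PC
  ... | inDᵢC , ¬above with inDᵢ⁻ C inDᵢC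
  ... | isDC , starts , len with firstCycle≡1m std (s≤s (s≤s z≤n)) isDC
  ... | a ∷ y ∷ t , Cs , refl with refl ← startsWith⇒third {n} {2} (concat C) starts with unique std
  ...   | 1∉ ∷ _ ∷ (2≢y ∷ _) ∷ _ = ⊥-elim (subst T (to T-not-≡ ¬above) (<⇒<ᵇ 2<y))
    where
    2<y : 2 < y
    2<y = ≤∧≢⇒< (≤∧≢⇒< (proj₁ (sound std (there (there (there (here refl)))))) (All.lookup 1∉ (there (there (here refl))))) 2≢y
  forth-ok {C} std PC | inDᵢC , ¬above | isDC , starts , len | a ∷ [] , Cs , refl
    with refl ← startsWith⇒third {n} {2} (concat C) starts = contradiction (proj₂ (isD⁻ C isDC)) (no-short-first-cycle std)
  forth-ok {C} std PC | inDᵢC , ¬above | isDC , starts , len | [] , Cs , refl =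
    std′ , inD⁺ (forth C) (isD⁺ (forth C) allLong′ avoids′) (trans (length-mapC _ Cs) (suc-injective len)) ,
    cong ((1 ∷ n ∷ []) ∷_) (mapC-inverse (punchIn 1) (punchOut 1) Cs (punchIn-punchOut ∘ ≢1))
    where
    stdCs : Standard (InRangeExcept (suc m) 1) Cs
    stdCs = forth-standard std
    std′ : Standard (InRange m) (forth C)
    std′ = Standard-punchOut ≤-refl 1≤1+m stdCs
    ≢1 : ∀ {x} → x ∈ concat Cs → x ≢ 1
    ≢1 = proj₂ ∘ sound stdCs
    allLong′ : T (allLong (forth C))
    allLong′ = subst T (sym (allLong-mapC (punchOut 1) Cs)) (proj₁ (isD⁻ C isDC))
    avoids′ : Avoids (concat (forth C))
    avoids′ = trans (avoids-punchOut 1 Cs ≢1) (avoids-tail n (concat Cs) (avoids-tail 1 (n ∷ concat Cs) (proj₂ (isD⁻ C isDC))))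

  back-ok : InvertibleOn m Q n P back forth
  back-ok {C} std QC with inD⁻ C QC
  ... | isDC , len with head≡1 std (≤-trans (s≤s z≤n) 3≤m)
  ... | t , Cs , refl =
    std′ , from T-∧ (inDᵢ⁺ {n} {2} (back C) (isD⁺ (back C) allLong′ avoids′) starts′ (cong suc (trans (length-mapC g C) len))
                    , tt) ,
    mapC-inverse (punchOut 1) (punchIn 1) C (λ _ → punchOut-punchIn {1})
    where
    g = punchIn 1
    W = map g (t ++ concat Cs)
    std′ : Standard (InRange n) (back C)
    std′ = back-standard std
    concat≡ : concat (back C) ≡ 1 ∷ n ∷ 2 ∷ W
    concat≡ = cong (λ w → 1 ∷ n ∷ w) (concat-mapC g C)
    allLong′ : T (allLong (back C))
    allLong′ = subst T (sym (allLong-mapC g C)) (proj₁ (isD⁻ C isDC))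
    avoids′ : Avoids (concat (back C))
    avoids′ = begin
      contains12-3 (concat (back C))   ≡⟨ cong contains12-3 concat≡ ⟩
      contains12-3 (1 ∷ n ∷ 2 ∷ W)     ≡⟨ contains12-3-skip-max 1 (2 ∷ W) ≤n ⟩
      contains12-3 (n ∷ 2 ∷ W)         ≡⟨ contains12-3-skip-descent W (s≤s (s≤s (≤-trans (s≤s z≤n) 3≤m))) ⟩
      contains12-3 (map g (concat C))  ≡⟨ contains12-3-punchIn 1 (concat C) ⟩
      contains12-3 (concat C)          ≡⟨ proj₂ (isD⁻ C isDC) ⟩
      false                            ∎
      where
      open ≡-Reasoning
      ≤n = All.tail (All.tail (subst (All (_≤ n)) concat≡ (letters≤ std′)))
    starts′ : T (startsWith1ni n 2 (concat (back C)))
    starts′ = subst (T ∘ startsWith1ni n 2) (sym concat≡) (startsWith1ni⁺ n 2 W)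

  countForms-deleteFirstCycle : countForms (suc (suc m)) P ≡ countForms m Q
  countForms-deleteFirstCycle = countForms-bij forth-ok back-ok

-- The recurrences

countForms-noCycles : ∀ {n} i (P : Cycles → Bool) → 1 ≤ n → countForms n (λ C → inDᵢ n i 0 C ∧ P C) ≡ 0
countForms-noCycles {n} i P 1≤n = countForms-none (λ C → inDᵢ n i 0 C ∧ P C) λ {C} std p →
  let (_ , _ , len) = inDᵢ⁻ C (proj₁ (to (T-∧ {inDᵢ n i 0 C}) p)) in
  case head≡1 std 1≤n of λ { (_ , _ , refl) → contradiction len λ () }

-- the fourth letter of (1 m+1 m y …) cannot exceed m, as m + 1 is already used
countForms-fourthAbove-last : ∀ {m} k → 2 ≤ m → countForms (suc m) (λ C → inDᵢ (suc m) m k C ∧ fourthAbove m C) ≡ 0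
countForms-fourthAbove-last {m} k 2≤m = countForms-none _ λ {C} std p → impossible std p
  where
  impossible : ∀ {C} → Standard (InRange (suc m)) C → ¬ T (inDᵢ (suc m) m k C ∧ fourthAbove m C)
  impossible {C} std p with to T-∧ p
  ... | inDᵢC , above with inDᵢ⁻ C inDᵢC
  -- on shorter first cycles `above : T false` is empty, so those cases need no clause
  ... | isDC , starts , _ with firstCycle≡1m std (s≤s (≤-trans (s≤s z≤n) 2≤m)) isDC
  ... | a ∷ y ∷ t , Cs , refl with refl ← startsWith⇒third {suc m} {m} (concat C) starts with unique std
  ...   | _ ∷ 1+m∉ ∷ _ =
    All.lookup 1+m∉ (there (here refl)) (≤-antisym (<ᵇ⇒< m y above) (proj₂ (sound std (there (there (there (here refl)))))))

third-bounds : ∀ {m C} → Standard (InRange m) C → 3 ≤ m → T (isD C) → 2 ≤ third (concat C) × third (concat C) < m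
third-bounds std 3≤m isDC with firstCycle≡1m std (≤-trans (s≤s (s≤s z≤n)) 3≤m) isDC
... | t , Cs , refl with j , r , rest≡ , 2≤j , j<m ← third-exists std 3≤m =
  subst (λ w → 2 ≤ third (1 ∷ _ ∷ w)) (sym rest≡) 2≤j , subst (λ w → third (1 ∷ _ ∷ w) < _) (sym rest≡) j<m

inDᵢ≡inD∧third : ∀ {N j k C} → Standard (InRange N) C → 3 ≤ N → inDᵢ N j k C ≡ inD k C ∧ (third (concat C) ≡ᵇ j)
inDᵢ≡inD∧third {N} {j} {k} {C} std 3≤N = T-⇔⇒≡
  (λ p → let (isDC , starts , len) = inDᵢ⁻ C p in
         from T-∧ (inD⁺ C isDC len , ≡⇒≡ᵇ _ _ (startsWith⇒third {N} {j} (concat C) starts)))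
  (λ p → let (inDC , third≡) = to T-∧ p ; (isDC , len) = inD⁻ C inDC in
         inDᵢ⁺ {N} {j} C isDC (starts isDC (≡ᵇ⇒≡ _ j third≡)) len)
  where
  starts : T (isD C) → third (concat C) ≡ j → T (startsWith1ni N j (concat C))
  starts isDC third≡ with firstCycle≡1m std (≤-trans (s≤s (s≤s z≤n)) 3≤N) isDC
  ... | t , Cs , refl with j′ , r , rest≡ , _ ← third-exists std 3≤N =
    subst (λ w → T (startsWith1ni N j (1 ∷ N ∷ w))) (sym rest≡)
      (subst (λ x → T (startsWith1ni N j (1 ∷ N ∷ x ∷ r))) (sym j′≡j) (startsWith1ni⁺ N j r))
    where
    j′≡j : j′ ≡ j
    j′≡j = trans (sym (cong (λ w → third (1 ∷ N ∷ w)) rest≡)) third≡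

∧-<ᵇ-suc-≡ᵇ : ∀ b x y → ((b ∧ (x <ᵇ suc y)) ∧ (x ≡ᵇ y)) ≡ (b ∧ (x ≡ᵇ y))
∧-<ᵇ-suc-≡ᵇ false x y = refl
∧-<ᵇ-suc-≡ᵇ true  x y = T-⇔⇒≡ (proj₂ ∘ to T-∧) λ x≡ᵇy →
  from T-∧ (<⇒<ᵇ (s≤s (≤-reflexive (≡ᵇ⇒≡ x y x≡ᵇy))) , x≡ᵇy)

∧-<ᵇ-suc-≢ᵇ : ∀ b x y → ((b ∧ (x <ᵇ suc y)) ∧ not (x ≡ᵇ y)) ≡ (b ∧ (x <ᵇ y))
∧-<ᵇ-suc-≢ᵇ false x y = refl
∧-<ᵇ-suc-≢ᵇ true  x y = T-⇔⇒≡
  (λ p → let (x<1+y , x≢ᵇy) = to T-∧ p in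
         <⇒<ᵇ (≤∧≢⇒< (≤-pred (<ᵇ⇒< x (suc y) x<1+y)) λ x≡y → subst T (to T-not-≡ x≢ᵇy) (≡⇒≡ᵇ x y x≡y)))
  (λ x<ᵇy → let x<y = <ᵇ⇒< x y x<ᵇy in
            from T-∧ (<⇒<ᵇ (m≤n⇒m≤1+n x<y) , from T-not-≡ (≢⇒≡ᵇ-false (<⇒≢ x<y))))

sum-wi≡countForms : ∀ {N} k r → 3 ≤ N →
  sum (map (λ j → wi N (2 + j) k) (upTo r)) ≡ countForms N (λ C → inD k C ∧ (third (concat C) <ᵇ 2 + r))
sum-wi≡countForms {N} k zero 3≤N = sym (countForms-none _ λ {C} std p →
  let (inDC , third<2) = to T-∧ p in
  <⇒≱ (<ᵇ⇒< _ 2 third<2) (proj₁ (third-bounds std 3≤N (proj₁ (inD⁻ C inDC)))))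
sum-wi≡countForms {N} k (suc r) 3≤N = begin
  sum (map f (upTo (suc r)))                          ≡⟨ cong (sum ∘ map f) (upTo-∷ʳ r) ⟨
  sum (map f (upTo r ∷ʳ r))                           ≡⟨ cong sum (map-++ f (upTo r) [ r ]) ⟩
  sum (map f (upTo r) ++ [ f r ])                     ≡⟨ sum-++ (map f (upTo r)) [ f r ] ⟩
  sum (map f (upTo r)) + (f r + 0)                    ≡⟨ cong₂ _+_ (sum-wi≡countForms k r 3≤N) (+-identityʳ (f r)) ⟩
  countForms N (below (2 + r)) + f r                  ≡⟨ +-comm _ (f r) ⟩
  f r + countForms N (below (2 + r))                  ≡⟨ cong₂ _+_ third≡ third≢ ⟩
  countForms N (λ C → below (3 + r) C ∧ isThird C)
    + countForms N (λ C → below (3 + r) C ∧ not (isThird C)) ≡⟨ countForms-split N (below (3 + r)) isThird ⟨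
  countForms N (below (3 + r))                        ∎
  where
  open ≡-Reasoning
  f : ℕ → ℕ
  f j = wi N (2 + j) k
  below : ℕ → Cycles → Bool
  below i C = inD k C ∧ (third (concat C) <ᵇ i)
  isThird : Cycles → Bool
  isThird C = third (concat C) ≡ᵇ 2 + r
  third≡ : f r ≡ countForms N (λ C → below (3 + r) C ∧ isThird C)
  third≡ = trans (wi≡countForms N (2 + r) k) (countForms-cong {N} _ _ λ {C} std →
    trans (inDᵢ≡inD∧third std 3≤N) (sym (∧-<ᵇ-suc-≡ᵇ (inD k C) (third (concat C)) (2 + r))))
  third≢ : countForms N (below (2 + r)) ≡ countForms N (λ C → below (3 + r) C ∧ not (isThird C))
  third≢ = countForms-cong {N} _ _ λ {C} _ → sym (∧-<ᵇ-suc-≢ᵇ (inD k C) (third (concat C)) (2 + r))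

wi-last : ∀ m → 3 ≤ m → wi (suc m) m ≈ₚ w m
wi-last m 3≤m k = begin
  wi (suc m) m k                                                    ≡⟨ wi≡countForms (suc m) m k ⟩
  countForms (suc m) (inDᵢ (suc m) m k)                             ≡⟨ countForms-split (suc m) (inDᵢ (suc m) m k) (fourthAbove m) ⟩
  countForms (suc m) (λ C → inDᵢ (suc m) m k C ∧ fourthAbove m C)
    + countForms (suc m) (λ C → inDᵢ (suc m) m k C ∧ not (fourthAbove m C))
      ≡⟨ cong₂ _+_ (countForms-fourthAbove-last k (≤-trans (n≤1+n 2) 3≤m)) (DeleteThird.countForms-deleteThird 3≤m ≤-refl k) ⟩
  countForms m (λ C → inD k C ∧ (third (concat C) <ᵇ m))            ≡⟨ countForms-cong {m} _ _ third<m ⟩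
  countForms m (inD k)                                              ≡⟨ w≡countForms m k ⟨
  w m k                                                             ∎
  where
  open ≡-Reasoning
  third<m : ∀ {C} → Standard (InRange m) C → (inD k C ∧ (third (concat C) <ᵇ m)) ≡ inD k C
  third<m {C} std = T-⇔⇒≡ (proj₁ ∘ to T-∧) λ p →
    from T-∧ (p , <⇒<ᵇ (proj₂ (third-bounds std 3≤m (proj₁ (inD⁻ C p)))))

wi-two : ∀ m → 3 ≤ m → wi (suc (suc m)) 2 ≈ₚ [1+y]· w m
wi-two m 3≤m k = begin
  wi n 2 k                                                          ≡⟨ wi≡countForms n 2 k ⟩
  countForms n (inDᵢ n 2 k)                                         ≡⟨ countForms-split n (inDᵢ n 2 k) (fourthAbove 2) ⟩
  countForms n (λ C → inDᵢ n 2 k C ∧ fourthAbove 2 C)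
    + countForms n (λ C → inDᵢ n 2 k C ∧ not (fourthAbove 2 C))
      ≡⟨ cong₂ _+_ (trans (DeleteSecondThird.countForms-deleteSecondThird ≤-refl 2≤m k) (sym (w≡countForms m k))) (firstCycle-1n k) ⟩
  w m k + (y· w m) k                                                ∎
  where
  open ≡-Reasoning
  n = suc (suc m)
  2≤m = ≤-trans (n≤1+n 2) 3≤m
  firstCycle-1n : ∀ k → countForms n (λ C → inDᵢ n 2 k C ∧ not (fourthAbove 2 C)) ≡ (y· w m) k
  firstCycle-1n zero    = countForms-noCycles {n} 2 (not ∘ fourthAbove 2) (s≤s z≤n)
  firstCycle-1n (suc k) = trans (DeleteFirstCycle.countForms-deleteFirstCycle 3≤m k) (sym (w≡countForms m k))

wi-middle : ∀ m i → 3 ≤ i → i ≤ m → wi (suc (suc m)) i ≈ₚ w m ⊕ ΣP 2 (i ∸ 1) (wi (suc m))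
wi-middle m i@(suc (suc r)) 3≤i@(s≤s (s≤s _)) i≤m k = begin
  wi n i k                                                          ≡⟨ wi≡countForms n i k ⟩
  countForms n (inDᵢ n i k)                                         ≡⟨ countForms-split n (inDᵢ n i k) (fourthAbove i) ⟩
  countForms n (λ C → inDᵢ n i k C ∧ fourthAbove i C)
    + countForms n (λ C → inDᵢ n i k C ∧ not (fourthAbove i C))
      ≡⟨ cong₂ _+_ (trans (DeleteSecondThird.countForms-deleteSecondThird (≤-trans (n≤1+n 2) 3≤i) i≤m k) (sym (w≡countForms m k)))
                   (trans (DeleteThird.countForms-deleteThird 3≤i (m≤n⇒m≤1+n i≤m) k) (sym (sum-wi≡countForms k r 3≤1+m))) ⟩
  w m k + ΣP 2 (i ∸ 1) (wi (suc m)) k                               ∎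
  where
  open ≡-Reasoning
  n = suc (suc m)
  3≤1+m = m≤n⇒m≤1+n (≤-trans 3≤i i≤m)

wi₃₂ : wi 3 2 ≈ₚ yˆ 1
wi₃₂ = λ { 0 → refl ; 1 → refl ; 2 → refl ; (suc (suc (suc _))) → refl }

wi₄₃ : wi 4 3 ≈ₚ yˆ 1
wi₄₃ = λ { 0 → refl ; 1 → refl ; 2 → refl ; (suc (suc (suc _))) → refl }

wi₄₂ : wi 4 2 ≈ₚ yˆ 2 ⊕ yˆ 1
wi₄₂ = λ { 0 → refl ; 1 → refl ; 2 → refl ; (suc (suc (suc _))) → refl }

lemma2p8 :
    ((n : ℕ) → 5 ≤ n →
        ((i : ℕ) → 3 ≤ i → i ≤ n ∸ 2 →
           wi n i ≈ₚ w (n ∸ 2) ⊕ ΣP 2 (i ∸ 1) (wi (n ∸ 1)))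
      × (wi n 2 ≈ₚ [1+y]· w (n ∸ 2))
      × (wi n (n ∸ 1) ≈ₚ w (n ∸ 1)))
    × (wi 3 2 ≈ₚ yˆ 1)
    × (wi 4 3 ≈ₚ yˆ 1)
    × (wi 4 2 ≈ₚ yˆ 2 ⊕ yˆ 1)
lemma2p8 =
  (λ { (suc (suc m)) (s≤s (s≤s 3≤m)) → wi-middle m , wi-two m 3≤m , wi-last (suc m) (m≤n⇒m≤1+n 3≤m) }) ,
  wi₃₂ , wi₄₃ , wi₄₂
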